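{- Let $p>2$ be a prime. (i) Let $b,\overline{b},a,d$ be non-negative integers such that $ad=b+\overline{b}>0$ and $\gcd(a,p)=1$. Then $$\sum_{k=1}^{p-1}\frac{(-1)^{d-1}q^{bk}+q^{\overline{b} k}}{[ak]_q^d}\equiv b(1-q)[p]_q\sum_{k=1}^{p-1}\frac{q^{\overline{b} k}}{[ak]_q^d}-ad[p]_q\sum_{k=1}^{p-1}\frac{q^{\overline{b} k}}{[ak]_q^{d+1}} \pmod{[p]_q^2}$$ and $$\sum_{k=1}^{p-1}\frac{(-1)^k((-1)^{d}q^{bk}+q^{\overline{b} k})}{[ak]_q^d}\equiv b(1-q)[p]_q\sum_{k=1}^{p-1}\frac{(-1)^kq^{\overline{b} k}}{[ak]_q^d}-ad[p]_q\sum_{k=1}^{p-1}\frac{(-1)^kq^{\overline{b} k}}{[ak]_q^{d+1}}\pmod{[p]_q^2}.$$ (ii) Let $b_1,\overline{b}_1,b_2,\overline{b}_2$ be non-negative integers with $d_1=b_1+\overline{b}_1>0$ and $d_2=b_2+\overline{b}_2>0$. Then $$\sum_{1\leq j<k\leq p-1}\frac{q^{b_1 j+b_2 k}+(-1)^{d_1+d_2}q^{\overline{b}_1 j+\overline{b}_2 k}}{[j]_q^{d_1}[k]_q^{d_2}}\equiv \sum_{j=1}^{p-1}\frac{q^{b_1 j}}{[j]_q^{d_1}}\cdot \sum_{k=1}^{p-1}\frac{q^{b_2 k}}{[k]_q^{d_2}}-\sum_{k=1}^{p-1}\frac{q^{(b_1+b_2) k}}{[k]_q^{d_1+d_2}}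 \pmod{[p]_q}.$$
   Context: For a nonnegative integer $n$, $[n]_q=\frac{1-q^n}{1-q}=1+q+\dots+q^{n-1}$. Two rational functions in $q$ are said to be congruent modulo $[p]_q^r$ ($r\ge1$) if the numerator of their difference is divisible by $[p]_q^r$ in the polynomial ring $\mathbb{Z}[q]$ and the denominator is relatively prime to $[p]_q$. -}

module Defs where

open import Data.Nat as ℕ using (ℕ; zero; suc)
open import Data.Integer as ℤ using (ℤ; +_)
open import Data.List using (List; []; _∷_; replicate; _++_; map)
open import Data.Product using (Σ; _×_)
open import Relation.Binary.PropositionalEquality using (_≡_)

-- Polynomials in ℤ[q], as coefficient lists (constant term first).

Poly : Set
Poly = List ℤ

infixl 6 _+P_ _-P_
infixl 7 _*P_ _•P_
infixr 8 _^P_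

_+P_ : Poly → Poly → Poly
[] +P ys = ys
(x ∷ xs) +P [] = x ∷ xs
(x ∷ xs) +P (y ∷ ys) = (x ℤ.+ y) ∷ (xs +P ys)

_•P_ : ℤ → Poly → Poly
c •P xs = map (c ℤ.*_) xs

_*P_ : Poly → Poly → Poly
[] *P ys = []
(x ∷ xs) *P ys = (x •P ys) +P ((+ 0) ∷ (xs *P ys))

-P_ : Poly → Poly
-P xs = ℤ.-1ℤ •P xs

_-P_ : Poly → Poly → Poly
xs -P ys = xs +P (-P ys)

oneP : Poly
oneP = + 1 ∷ []

qPow : ℕ → Poly
qPow n = replicate n (+ 0) ++ (+ 1 ∷ [])

-- [n]_q = 1 + q + ... + q^(n-1)
qInt : ℕ → Poly
qInt n = replicate n (+ 1)

_^P_ : Poly → ℕ → Poly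
P ^P zero = oneP
P ^P suc n = P *P (P ^P n)

coeff : Poly → ℕ → ℤ
coeff [] n = + 0
coeff (x ∷ xs) zero = x
coeff (x ∷ xs) (suc n) = coeff xs n

-- equality of polynomials (up to trailing zero coefficients)
_≈P_ : Poly → Poly → Set
P ≈P Q = ∀ n → coeff P n ≡ coeff Q n

_∣P_ : Poly → Poly → Set
M ∣P P = Σ Poly (λ Q → P ≈P (M *P Q))

CoprimeP : Poly → Poly → Set
CoprimeP A B = ∀ G → G ∣P A → G ∣P B → G ∣P oneP

sgn : ℕ → ℤ
sgn zero = + 1
sgn (suc n) = ℤ.- sgn n

record Frac : Set where
  constructor _/_
  field
    num : Poly
    den : Poly
open Frac public

infixl 6 _+F_ _-F_
infixl 7 _*F_

_+F_ : Frac → Frac → Frac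
(a / b) +F (c / d) = ((a *P d) +P (c *P b)) / (b *P d)

_*F_ : Frac → Frac → Frac
(a / b) *F (c / d) = (a *P c) / (b *P d)

-F_ : Frac → Frac
-F (a / b) = (-P a) / b

_-F_ : Frac → Frac → Frac
x -F y = x +F (-F y)

polyF : Poly → Frac
polyF P = P / oneP

zeroF : Frac
zeroF = [] / oneP

-- sumF f n = f 0 + f 1 + ... + f (n-1)
sumF : (ℕ → Frac) → ℕ → Frac
sumF f zero = zeroF
sumF f (suc n) = sumF f n +F f n

Σ1to : ℕ → (ℕ → Frac) → Frac
Σ1to m f = sumF (λ i → f (suc i)) m

-- Congruence of rational functions modulo [p]_q^r:
-- the (cross-multiplied) numerator of the difference is divisible by
-- [p]_q^r in ℤ[q], and the denominators are relatively prime to [p]_q.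
CongF : ℕ → ℕ → Frac → Frac → Set
CongF p r x y =
  CoprimeP (den x) (qInt p) × CoprimeP (den y) (qInt p) ×
  ((qInt p ^P r) ∣P ((num x *P den y) -P (num y *P den x)))

lhs1 rhs1 lhs2 rhs2 : ℕ → ℕ → ℕ → ℕ → ℕ → Frac
lhs1 p b b̄ a d = Σ1to (p ℕ.∸ 1) (λ k →
  ((sgn (d ℕ.∸ 1) •P qPow (b ℕ.* k)) +P qPow (b̄ ℕ.* k)) / (qInt (a ℕ.* k) ^P d))
rhs1 p b b̄ a d =
  (polyF ((+ b) •P ((oneP -P qPow 1) *P qInt p))
     *F Σ1to (p ℕ.∸ 1) (λ k → qPow (b̄ ℕ.* k) / (qInt (a ℕ.* k) ^P d)))
  -F (polyF ((+ (a ℕ.* d)) •P qInt p)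
     *F Σ1to (p ℕ.∸ 1) (λ k → qPow (b̄ ℕ.* k) / (qInt (a ℕ.* k) ^P suc d)))
lhs2 p b b̄ a d = Σ1to (p ℕ.∸ 1) (λ k →
  (sgn k •P ((sgn d •P qPow (b ℕ.* k)) +P qPow (b̄ ℕ.* k))) / (qInt (a ℕ.* k) ^P d))
rhs2 p b b̄ a d =
  (polyF ((+ b) •P ((oneP -P qPow 1) *P qInt p))
     *F Σ1to (p ℕ.∸ 1) (λ k → (sgn k •P qPow (b̄ ℕ.* k)) / (qInt (a ℕ.* k) ^P d)))
  -F (polyF ((+ (a ℕ.* d)) •P qInt p)
     *F Σ1to (p ℕ.∸ 1) (λ k → (sgn k •P qPow (b̄ ℕ.* k)) / (qInt (a ℕ.* k) ^P suc d)))

lhs3 rhs3 : ℕ → ℕ → ℕ → ℕ → ℕ → Frac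
-- Σ_{1 ≤ j < k ≤ p-1}
lhs3 p b₁ b̄₁ b₂ b̄₂ = Σ1to (p ℕ.∸ 1) (λ k → Σ1to (k ℕ.∸ 1) (λ j →
  (qPow (b₁ ℕ.* j ℕ.+ b₂ ℕ.* k)
     +P (sgn ((b₁ ℕ.+ b̄₁) ℕ.+ (b₂ ℕ.+ b̄₂)) •P qPow (b̄₁ ℕ.* j ℕ.+ b̄₂ ℕ.* k)))
  / ((qInt j ^P (b₁ ℕ.+ b̄₁)) *P (qInt k ^P (b₂ ℕ.+ b̄₂)))))
rhs3 p b₁ b̄₁ b₂ b̄₂ =
  (Σ1to (p ℕ.∸ 1) (λ j → qPow (b₁ ℕ.* j) / (qInt j ^P (b₁ ℕ.+ b̄₁)))
    *F Σ1to (p ℕ.∸ 1) (λ k → qPow (b₂ ℕ.* k) / (qInt k ^P (b₂ ℕ.+ b̄₂))))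
  -F Σ1to (p ℕ.∸ 1) (λ k →
       qPow ((b₁ ℕ.+ b₂) ℕ.* k) / (qInt k ^P ((b₁ ℕ.+ b̄₁) ℕ.+ (b₂ ℕ.+ b̄₂))))

module Submission where

-- The congruences are proved by reducing rational functions to polynomials in the quotient
-- rings ℤ[q]/([p]) and ℤ[q]/([p]²).  Every denominator is a product of q-integers [m] with
-- p ∤ m, and such an [m] is a unit modulo [p]: a Bézout identity 1 + y p = x m gives
-- [m] (1 + q^m + ⋯ + q^{m(x−1)}) = [x m] ≡ 1; one Newton step lifts the inverse to [p]².
--
-- The arithmetic input is the reflection k ↦ p − k.  Since q^m [n − m] = [n] − [m], the
-- inverse of [n − m] is −q^m [m]⁻¹ (1 + [n][m]⁻¹) whenever [n]² ≡ 0 (complement-inverse).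
-- In part (i) (n = a p, modulo [p]²) one has [ap] ≡ a[p] and q^{bp} ≡ 1 − b(1 − q)[p], and
-- pairing the k-th with the (p − k)-th summand yields the two correction sums.  In part (ii)
-- (n = p, modulo [p]) the reflection exchanges q^{bj}/[j]^d and (−1)^d q^{b̄j}/[j]^d, which
-- turns the square of a sum into the triangular sum.

open import Defs
open import Data.Nat using (ℕ; _+_; _*_; _<_)
open import Data.Nat.GCD using (gcd)
open import Data.Nat.Primality using (Prime)
open import Data.Product using (_×_)
open import Relation.Binary.PropositionalEquality using (_≡_)

open import Data.Nat using (zero; suc; _∸_; _≤_; z≤n; s≤s)
import Data.Nat.Properties as ℕP
open import Data.Nat.GCD using (module Bézout)
open import Data.Nat.Coprimality as Coprimality using (Coprime; coprime-Bézout)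
open import Data.Nat.Divisibility using (_∣_; divides; ∣-trans)
open import Data.Nat.Primality using (prime⇒irreducible)
open import Data.Sum using (_⊎_; inj₁; inj₂; [_,_]′)
open import Data.Empty using (⊥-elim)
open import Data.Integer as ℤ using (ℤ; +_) renaming (_+_ to _+ℤ_; _*_ to _*ℤ_)
import Data.Integer.Properties as ℤP
open import Data.List using ([]; _∷_)
open import Data.Maybe using (Maybe; just; nothing)
open import Data.Product using (Σ; _,_; proj₁; proj₂)
open import Relation.Nullary using (yes; no)
open import Relation.Binary.PropositionalEquality using (refl; cong; cong₂; sym; trans; subst)
open import Algebra.Bundles using (CommutativeRing)
open import Relation.Binary.Bundles using (Setoid)
import Relation.Binary.Reasoning.Setoid
import Algebra.Solver.Ring as RingSolver
open import Algebra.Solver.Ring.AlmostCommutativeRing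
  using (fromCommutativeRing; _-Raw-AlmostCommutative⟶_)
import Data.Integer.Solver
import Data.Nat.Solver
import Relation.Binary.PropositionalEquality as Eq

module ℤSolver = Data.Integer.Solver.+-*-Solver
module ℕSolver = Data.Nat.Solver.+-*-Solver

module Polynomials where

  -- Equality of coefficient lists up to trailing zeros, wrapped in a record so that the two
  -- polynomials can be inferred from a proof of equality.
  infix 4 _≋_
  record _≋_ (P Q : Poly) : Set where
    constructor mk≋
    field at : P ≈P Q
  open _≋_ public

  ≋-refl : ∀ {P} → P ≋ P
  ≋-refl = mk≋ (λ n → refl)

  ≋-sym : ∀ {P Q} → P ≋ Q → Q ≋ P
  ≋-sym e = mk≋ (λ n → sym (at e n))

  ≋-trans : ∀ {P Q R} → P ≋ Q → Q ≋ R → P ≋ R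
  ≋-trans e f = mk≋ (λ n → trans (at e n) (at f n))

  ≋-setoid : Setoid _ _
  ≋-setoid = record { Carrier = Poly ; _≈_ = _≋_
                    ; isEquivalence = record { refl = ≋-refl ; sym = ≋-sym ; trans = ≋-trans } }

  ≡⇒≋ : ∀ {P Q} → P ≡ Q → P ≋ Q
  ≡⇒≋ refl = ≋-refl

  cst : ℤ → Poly
  cst c = c ∷ []

  shift : Poly → Poly
  shift R = + 0 ∷ R

  coeff-+ : ∀ P Q n → coeff (P +P Q) n ≡ coeff P n +ℤ coeff Q n
  coeff-+ [] Q n = sym (ℤP.+-identityˡ _)
  coeff-+ (x ∷ P) [] zero = sym (ℤP.+-identityʳ _)
  coeff-+ (x ∷ P) [] (suc n) = sym (ℤP.+-identityʳ _)
  coeff-+ (x ∷ P) (y ∷ Q) zero = refl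
  coeff-+ (x ∷ P) (y ∷ Q) (suc n) = coeff-+ P Q n

  coeff-• : ∀ c P n → coeff (c •P P) n ≡ c *ℤ coeff P n
  coeff-• c [] n = sym (ℤP.*-zeroʳ c)
  coeff-• c (x ∷ P) zero = refl
  coeff-• c (x ∷ P) (suc n) = coeff-• c P n

  coeff-* : ∀ x P Q n → coeff ((x ∷ P) *P Q) n ≡ x *ℤ coeff Q n +ℤ coeff (shift (P *P Q)) n
  coeff-* x P Q n = trans (coeff-+ (x •P Q) (shift (P *P Q)) n) (cong (_+ℤ _) (coeff-• x Q n))

  ∷-≋ : ∀ {x y xs ys} → x ≡ y → xs ≋ ys → (x ∷ xs) ≋ (y ∷ ys)
  ∷-≋ {x} {y} {xs} {ys} e f = mk≋ g where
    g : (x ∷ xs) ≈P (y ∷ ys)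
    g zero = e
    g (suc n) = at f n

  shift-≋ : ∀ {xs ys} → xs ≋ ys → shift xs ≋ shift ys
  shift-≋ = ∷-≋ refl

  shift-[] : shift [] ≋ []
  shift-[] = mk≋ λ { zero → refl ; (suc n) → refl }

  +-cong : ∀ {P P' Q Q'} → P ≋ P' → Q ≋ Q' → (P +P Q) ≋ (P' +P Q')
  +-cong {P} {P'} {Q} {Q'} e f = mk≋ λ n →
    trans (coeff-+ P Q n) (trans (cong₂ _+ℤ_ (at e n) (at f n)) (sym (coeff-+ P' Q' n)))

  •-cong : ∀ c {P P'} → P ≋ P' → (c •P P) ≋ (c •P P')
  •-cong c {P} {P'} e = mk≋ λ n →
    trans (coeff-• c P n) (trans (cong (c *ℤ_) (at e n)) (sym (coeff-• c P' n)))

  -‿cong : ∀ {P P'} → P ≋ P' → (-P P) ≋ (-P P')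
  -‿cong = •-cong ℤ.-1ℤ

  +-comm : ∀ P Q → (P +P Q) ≋ (Q +P P)
  +-comm P Q = mk≋ λ n →
    trans (coeff-+ P Q n) (trans (ℤP.+-comm (coeff P n) (coeff Q n)) (sym (coeff-+ Q P n)))

  +-assoc : ∀ P Q R → ((P +P Q) +P R) ≋ (P +P (Q +P R))
  +-assoc P Q R = mk≋ λ n → begin
      coeff ((P +P Q) +P R) n                  ≡⟨ coeff-+ (P +P Q) R n ⟩
      coeff (P +P Q) n +ℤ coeff R n             ≡⟨ cong (_+ℤ coeff R n) (coeff-+ P Q n) ⟩
      (coeff P n +ℤ coeff Q n) +ℤ coeff R n     ≡⟨ ℤP.+-assoc (coeff P n) _ _ ⟩
      coeff P n +ℤ (coeff Q n +ℤ coeff R n)     ≡⟨ cong (coeff P n +ℤ_) (coeff-+ Q R n) ⟨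
      coeff P n +ℤ coeff (Q +P R) n             ≡⟨ coeff-+ P (Q +P R) n ⟨
      coeff (P +P (Q +P R)) n                  ∎
    where open Eq.≡-Reasoning

  +-idʳ : ∀ P → (P +P []) ≋ P
  +-idʳ P = mk≋ λ n → trans (coeff-+ P [] n) (ℤP.+-identityʳ _)

  neg-invˡ : ∀ P → ((-P P) +P P) ≋ []
  neg-invˡ P = mk≋ λ n → trans (coeff-+ (-P P) P n)
    (trans (cong (_+ℤ coeff P n) (trans (coeff-• ℤ.-1ℤ P n) (ℤP.-1*i≡-i _)))
           (ℤP.+-inverseˡ (coeff P n)))

  neg-invʳ : ∀ P → (P +P (-P P)) ≋ []
  neg-invʳ P = ≋-trans (+-comm P (-P P)) (neg-invˡ P)

  •-distrib : ∀ c P Q → (c •P (P +P Q)) ≋ ((c •P P) +P (c •P Q))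
  •-distrib c P Q = mk≋ λ n → begin
      coeff (c •P (P +P Q)) n                   ≡⟨ coeff-• c (P +P Q) n ⟩
      c *ℤ coeff (P +P Q) n                      ≡⟨ cong (c *ℤ_) (coeff-+ P Q n) ⟩
      c *ℤ (coeff P n +ℤ coeff Q n)              ≡⟨ ℤP.*-distribˡ-+ c _ _ ⟩
      c *ℤ coeff P n +ℤ c *ℤ coeff Q n           ≡⟨ cong₂ _+ℤ_ (coeff-• c P n) (coeff-• c Q n) ⟨
      coeff (c •P P) n +ℤ coeff (c •P Q) n       ≡⟨ coeff-+ (c •P P) (c •P Q) n ⟨
      coeff ((c •P P) +P (c •P Q)) n            ∎
    where open Eq.≡-Reasoning

  •-• : ∀ c d P → (c •P (d •P P)) ≋ ((c *ℤ d) •P P)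
  •-• c d P = mk≋ λ n → trans (coeff-• c (d •P P) n) (trans (cong (c *ℤ_) (coeff-• d P n))
    (trans (sym (ℤP.*-assoc c d _)) (sym (coeff-• (c *ℤ d) P n))))

  •-shift : ∀ c R → (c •P shift R) ≋ shift (c •P R)
  •-shift c R = mk≋ λ { zero → ℤP.*-zeroʳ c ; (suc n) → refl }

  0•-zero : ∀ P → (+ 0 •P P) ≋ []
  0•-zero P = mk≋ λ n → coeff-• (+ 0) P n

  1•-id : ∀ P → (+ 1 •P P) ≋ P
  1•-id P = mk≋ λ n → trans (coeff-• (+ 1) P n) (ℤP.*-identityˡ _)

  zero-*ˡ : ∀ P Q → [] ≋ P → [] ≋ (P *P Q)
  zero-*ˡ [] Q e = ≋-refl
  zero-*ˡ (x ∷ P) Q e = mk≋ λ n → sym (trans (coeff-* x P Q n)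
      (cong₂ _+ℤ_ (trans (cong (_*ℤ coeff Q n) (sym (at e zero))) (ℤP.*-zeroˡ (coeff Q n))) (shifted n)))
    where
    tail≋0 : [] ≋ (P *P Q)
    tail≋0 = zero-*ˡ P Q (mk≋ λ m → at e (suc m))
    shifted : ∀ n → coeff (shift (P *P Q)) n ≡ + 0
    shifted zero = refl
    shifted (suc n) = sym (at tail≋0 n)

  *-congˡ : ∀ {P P'} Q → P ≋ P' → (P *P Q) ≋ (P' *P Q)
  *-congˡ {[]} {[]} Q e = ≋-refl
  *-congˡ {[]} {x ∷ P'} Q e = zero-*ˡ (x ∷ P') Q e
  *-congˡ {x ∷ P} {[]} Q e = ≋-sym (zero-*ˡ (x ∷ P) Q (≋-sym e))
  *-congˡ {x ∷ P} {y ∷ P'} Q e =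
    +-cong (≡⇒≋ (cong (_•P Q) (at e zero))) (shift-≋ (*-congˡ {P} {P'} Q (mk≋ λ n → at e (suc n))))

  *-congʳ : ∀ P {Q Q'} → Q ≋ Q' → (P *P Q) ≋ (P *P Q')
  *-congʳ [] e = ≋-refl
  *-congʳ (x ∷ P) e = +-cong (•-cong x e) (shift-≋ (*-congʳ P e))

  *-cong : ∀ {P P' Q Q'} → P ≋ P' → Q ≋ Q' → (P *P Q) ≋ (P' *P Q')
  *-cong {P} {P'} {Q} {Q'} e f = ≋-trans (*-congˡ Q e) (*-congʳ P' f)

  *-zeroʳ : ∀ P → (P *P []) ≋ []
  *-zeroʳ [] = ≋-refl
  *-zeroʳ (x ∷ P) = ≋-trans (+-cong {x •P []} ≋-refl (shift-≋ (*-zeroʳ P))) shift-[]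

  *-distribʳ : ∀ P Q R → ((P +P Q) *P R) ≋ ((P *P R) +P (Q *P R))
  *-distribʳ [] Q R = ≋-refl
  *-distribʳ (x ∷ P) [] R = ≋-sym (+-idʳ _)
  *-distribʳ (x ∷ P) (y ∷ Q) R = mk≋ λ n → begin
      coeff (((x +ℤ y) ∷ (P +P Q)) *P R) n
        ≡⟨ coeff-* (x +ℤ y) (P +P Q) R n ⟩
      (x +ℤ y) *ℤ coeff R n +ℤ coeff (shift ((P +P Q) *P R)) n
        ≡⟨ cong ((x +ℤ y) *ℤ coeff R n +ℤ_) (trans (at (shift-≋ (*-distribʳ P Q R)) n) (shifted n)) ⟩
      (x +ℤ y) *ℤ coeff R n +ℤ (coeff (shift (P *P R)) n +ℤ coeff (shift (Q *P R)) n)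
        ≡⟨ ℤSolver.solve 5 (λ x y r a b → (x :+ y) :* r :+ (a :+ b) := (x :* r :+ a) :+ (y :* r :+ b))
             refl x y (coeff R n) _ _ ⟩
      (x *ℤ coeff R n +ℤ coeff (shift (P *P R)) n) +ℤ (y *ℤ coeff R n +ℤ coeff (shift (Q *P R)) n)
        ≡⟨ cong₂ _+ℤ_ (coeff-* x P R n) (coeff-* y Q R n) ⟨
      coeff ((x ∷ P) *P R) n +ℤ coeff ((y ∷ Q) *P R) n
        ≡⟨ coeff-+ ((x ∷ P) *P R) ((y ∷ Q) *P R) n ⟨
      coeff (((x ∷ P) *P R) +P ((y ∷ Q) *P R)) n ∎
    where
    open Eq.≡-Reasoning
    open ℤSolver
    shifted : ∀ n → coeff (shift ((P *P R) +P (Q *P R))) n ≡ coeff (shift (P *P R)) n +ℤ coeff (shift (Q *P R)) n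
    shifted zero = refl
    shifted (suc n) = coeff-+ (P *P R) (Q *P R) n

  *-distribˡ : ∀ P Q R → (P *P (Q +P R)) ≋ ((P *P Q) +P (P *P R))
  *-distribˡ [] Q R = ≋-refl
  *-distribˡ (x ∷ P) Q R = mk≋ λ n → begin
      coeff ((x ∷ P) *P (Q +P R)) n
        ≡⟨ coeff-* x P (Q +P R) n ⟩
      x *ℤ coeff (Q +P R) n +ℤ coeff (shift (P *P (Q +P R))) n
        ≡⟨ cong₂ (λ u v → x *ℤ u +ℤ v) (coeff-+ Q R n)
                 (trans (at (shift-≋ (*-distribˡ P Q R)) n) (shifted n)) ⟩
      x *ℤ (coeff Q n +ℤ coeff R n) +ℤ (coeff (shift (P *P Q)) n +ℤ coeff (shift (P *P R)) n)
        ≡⟨ ℤSolver.solve 5 (λ x q r a b → x :* (q :+ r) :+ (a :+ b) := (x :* q :+ a) :+ (x :* r :+ b))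
             refl x (coeff Q n) (coeff R n) _ _ ⟩
      (x *ℤ coeff Q n +ℤ coeff (shift (P *P Q)) n) +ℤ (x *ℤ coeff R n +ℤ coeff (shift (P *P R)) n)
        ≡⟨ cong₂ _+ℤ_ (coeff-* x P Q n) (coeff-* x P R n) ⟨
      coeff ((x ∷ P) *P Q) n +ℤ coeff ((x ∷ P) *P R) n
        ≡⟨ coeff-+ ((x ∷ P) *P Q) ((x ∷ P) *P R) n ⟨
      coeff (((x ∷ P) *P Q) +P ((x ∷ P) *P R)) n ∎
    where
    open Eq.≡-Reasoning
    open ℤSolver
    shifted : ∀ n → coeff (shift ((P *P Q) +P (P *P R))) n ≡ coeff (shift (P *P Q)) n +ℤ coeff (shift (P *P R)) n
    shifted zero = refl
    shifted (suc n) = coeff-+ (P *P Q) (P *P R) n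

  •-*ˡ : ∀ c P Q → ((c •P P) *P Q) ≋ (c •P (P *P Q))
  •-*ˡ c [] Q = ≋-refl
  •-*ˡ c (x ∷ P) Q =
    ≋-trans (+-cong (≋-sym (•-• c x Q)) (≋-trans (shift-≋ (•-*ˡ c P Q)) (≋-sym (•-shift c (P *P Q)))))
            (≋-sym (•-distrib c (x •P Q) (shift (P *P Q))))

  shift-*ˡ : ∀ P Q → (shift P *P Q) ≋ shift (P *P Q)
  shift-*ˡ P Q = +-cong (0•-zero Q) (≋-refl {shift (P *P Q)})

  *-assoc : ∀ P Q R → ((P *P Q) *P R) ≋ (P *P (Q *P R))
  *-assoc [] Q R = ≋-refl
  *-assoc (x ∷ P) Q R =
    ≋-trans (*-distribʳ (x •P Q) (shift (P *P Q)) R)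
            (+-cong (•-*ˡ x Q R) (≋-trans (shift-*ˡ (P *P Q) R) (shift-≋ (*-assoc P Q R))))

  *-shiftʳ : ∀ P Q → (P *P shift Q) ≋ shift (P *P Q)
  *-shiftʳ [] Q = ≋-sym shift-[]
  *-shiftʳ (x ∷ P) Q = +-cong (•-shift x Q) (shift-≋ (*-shiftʳ P Q))

  *-cstʳ : ∀ Q x → (Q *P cst x) ≋ (x •P Q)
  *-cstʳ [] x = ≋-refl
  *-cstʳ (y ∷ Q) x = mk≋ λ
    { zero → trans (ℤP.+-identityʳ _) (ℤP.*-comm y x)
    ; (suc n) → trans (coeff-+ (y •P []) (Q *P cst x) n) (trans (ℤP.+-identityˡ _) (at (*-cstʳ Q x) n)) }

  *-comm : ∀ P Q → (P *P Q) ≋ (Q *P P)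
  *-comm [] Q = ≋-sym (*-zeroʳ Q)
  *-comm (x ∷ P) Q = ≋-sym (begin
      Q *P (x ∷ P)                       ≈⟨ *-congʳ Q cons-split ⟩
      Q *P (cst x +P shift P)            ≈⟨ *-distribˡ Q (cst x) (shift P) ⟩
      (Q *P cst x) +P (Q *P shift P)     ≈⟨ +-cong (*-cstʳ Q x) (*-shiftʳ Q P) ⟩
      (x •P Q) +P shift (Q *P P)         ≈⟨ +-cong (≋-refl {x •P Q}) (shift-≋ (*-comm Q P)) ⟩
      (x •P Q) +P shift (P *P Q)         ∎)
    where
    open import Relation.Binary.Reasoning.Setoid ≋-setoid
    cons-split : (x ∷ P) ≋ (cst x +P shift P)
    cons-split = mk≋ λ { zero → sym (ℤP.+-identityʳ x) ; (suc n) → refl }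

  *-idˡ : ∀ P → (oneP *P P) ≋ P
  *-idˡ P = ≋-trans (+-cong (1•-id P) shift-[]) (+-idʳ P)

  *-idʳ : ∀ P → (P *P oneP) ≋ P
  *-idʳ P = ≋-trans (*-comm P oneP) (*-idˡ P)

  ℤ[q] : CommutativeRing _ _
  ℤ[q] = record
    { Carrier = Poly ; _≈_ = _≋_ ; _+_ = _+P_ ; _*_ = _*P_ ; -_ = -P_ ; 0# = [] ; 1# = oneP
    ; isCommutativeRing = record
      { isRing = record
        { +-isAbelianGroup = record
          { isGroup = record
            { isMonoid = record
              { isSemigroup = record
                { isMagma = record
                  { isEquivalence = record { refl = ≋-refl ; sym = ≋-sym ; trans = ≋-trans }
                  ; ∙-cong = +-cong }
                ; assoc = +-assoc }
              ; identity = (λ P → ≋-refl) , +-idʳ }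
            ; inverse = neg-invˡ , neg-invʳ
            ; ⁻¹-cong = -‿cong }
          ; comm = +-comm }
        ; *-cong = *-cong
        ; *-assoc = *-assoc
        ; *-identity = *-idˡ , *-idʳ
        ; distrib = *-distribˡ , (λ x y z → *-distribʳ y z x) }
      ; *-comm = *-comm } }

  cst-homomorphism : ℤ.+-*-rawRing -Raw-AlmostCommutative⟶ fromCommutativeRing ℤ[q]
  cst-homomorphism = record
    { ⟦_⟧ = cst
    ; +-homo = λ a b → ≋-refl
    ; *-homo = λ a b → mk≋ λ { zero → sym (ℤP.+-identityʳ _) ; (suc n) → refl }
    ; -‿homo = λ a → mk≋ λ { zero → sym (ℤP.-1*i≡-i a) ; (suc n) → refl }
    ; 0-homo = mk≋ λ { zero → refl ; (suc n) → refl }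
    ; 1-homo = ≋-refl }

  cst-* : ∀ x y → (cst x *P cst y) ≋ cst (x *ℤ y)
  cst-* x y = ≋-sym (_-Raw-AlmostCommutative⟶_.*-homo cst-homomorphism x y)

  •-as-* : ∀ c X → (c •P X) ≋ (cst c *P X)
  •-as-* c X = ≋-sym (≋-trans (+-cong (≋-refl {c •P X}) shift-[]) (+-idʳ _))

  cst-equal? : ∀ a b → Maybe (cst a ≋ cst b)
  cst-equal? a b with a ℤ.≟ b
  ... | yes refl = just ≋-refl
  ... | no _ = nothing

  module ℤ[q]-Solver = RingSolver ℤ.+-*-rawRing (fromCommutativeRing ℤ[q]) cst-homomorphism cst-equal?

open Polynomials

module Congruence (M : Poly) where

  infix 4 _~_
  record _~_ (X Y : Poly) : Set where
    constructor mk~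
    field
      quotient : Poly
      multiple : (X -P Y) ≋ (M *P quotient)

  ≋⇒~ : ∀ {X Y} → X ≋ Y → X ~ Y
  ≋⇒~ {X} {Y} e = mk~ [] (≋-trans (≋-trans (+-cong e ≋-refl) (neg-invʳ Y)) (≋-sym (*-zeroʳ M)))

  ~-refl : ∀ {X} → X ~ X
  ~-refl = ≋⇒~ ≋-refl

  ~-sym : ∀ {X Y} → X ~ Y → Y ~ X
  ~-sym {X} {Y} (mk~ w e) = mk~ (-P w)
    (≋-trans (solve 2 (λ X Y → Y :- X := :- (X :- Y)) ≋-refl X Y)
    (≋-trans (-‿cong e) (solve 2 (λ M w → :- (M :* w) := M :* (:- w)) ≋-refl M w)))
    where open ℤ[q]-Solver

  ~-trans : ∀ {X Y Z} → X ~ Y → Y ~ Z → X ~ Z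
  ~-trans {X} {Y} {Z} (mk~ w e) (mk~ v f) = mk~ (w +P v)
    (≋-trans (solve 3 (λ X Y Z → X :- Z := (X :- Y) :+ (Y :- Z)) ≋-refl X Y Z)
    (≋-trans (+-cong e f) (≋-sym (*-distribˡ M w v))))
    where open ℤ[q]-Solver

  ~+ : ∀ {X Y U V} → X ~ Y → U ~ V → (X +P U) ~ (Y +P V)
  ~+ {X} {Y} {U} {V} (mk~ w e) (mk~ v f) = mk~ (w +P v)
    (≋-trans (solve 4 (λ X Y U V → (X :+ U) :- (Y :+ V) := (X :- Y) :+ (U :- V)) ≋-refl X Y U V)
    (≋-trans (+-cong e f) (≋-sym (*-distribˡ M w v))))
    where open ℤ[q]-Solver

  ~* : ∀ {X Y U V} → X ~ Y → U ~ V → (X *P U) ~ (Y *P V)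
  ~* {X} {Y} {U} {V} (mk~ w e) (mk~ v f) = mk~ (w *P U +P Y *P v)
    (≋-trans (solve 4 (λ X Y U V → (X :* U) :- (Y :* V) := (X :- Y) :* U :+ Y :* (U :- V)) ≋-refl X Y U V)
    (≋-trans (+-cong (*-congˡ U e) (*-congʳ Y f))
    (solve 5 (λ M w U Y v → M :* w :* U :+ Y :* (M :* v) := M :* (w :* U :+ Y :* v)) ≋-refl M w U Y v)))
    where open ℤ[q]-Solver

  ~neg : ∀ {X Y} → X ~ Y → (-P X) ~ (-P Y)
  ~neg {X} {Y} (mk~ w e) = mk~ (-P w)
    (≋-trans (solve 2 (λ X Y → (:- X) :- (:- Y) := :- (X :- Y)) ≋-refl X Y)
    (≋-trans (-‿cong e) (solve 2 (λ M w → :- (M :* w) := M :* (:- w)) ≋-refl M w)))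
    where open ℤ[q]-Solver

  record Unit (D : Poly) : Set where
    constructor mkUnit
    field
      inverse : Poly
      invertible : (D *P inverse) ~ oneP
  open Unit public

  -- A unit modulo M is relatively prime to M in ℤ[q]: a common divisor G of D and M
  -- divides D·U − (D·U − 1) = 1.
  unit⇒coprime : ∀ {D} → Unit D → CoprimeP D M
  unit⇒coprime {D} (mkUnit U (mk~ w e)) G (A , D≈GA) (B , M≈GB) = (A *P U -P B *P w) , λ n → sym (at G·cofactor≈1 n)
    where
    open ℤ[q]-Solver
    G·cofactor≈1 : (G *P (A *P U -P B *P w)) ≋ oneP
    G·cofactor≈1 =
      ≋-trans (solve 5 (λ G A U B w → G :* (A :* U :- B :* w) := (G :* A) :* U :- (G :* B) :* w) ≋-refl G A U B w)
      (≋-trans (+-cong (*-congˡ U (≋-sym (mk≋ {D} {G *P A} D≈GA)))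
                       (-‿cong (*-congˡ w (≋-sym (mk≋ {M} {G *P B} M≈GB)))))
      (≋-trans (+-cong (≋-refl {D *P U}) (-‿cong (≋-sym e)))
      (solve 2 (λ D U → D :* U :- (D :* U :- con (+ 1)) := con (+ 1)) ≋-refl D U)))

  ℤ[q]/M : CommutativeRing _ _
  ℤ[q]/M = record
    { Carrier = Poly ; _≈_ = _~_ ; _+_ = _+P_ ; _*_ = _*P_ ; -_ = -P_ ; 0# = [] ; 1# = oneP
    ; isCommutativeRing = record
      { isRing = record
        { +-isAbelianGroup = record
          { isGroup = record
            { isMonoid = record
              { isSemigroup = record
                { isMagma = record
                  { isEquivalence = record { refl = ~-refl ; sym = ~-sym ; trans = ~-trans }
                  ; ∙-cong = ~+ }
                ; assoc = λ X Y Z → ≋⇒~ (+-assoc X Y Z) }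
              ; identity = (λ X → ~-refl) , (λ X → ≋⇒~ (+-idʳ X)) }
            ; inverse = (λ X → ≋⇒~ (neg-invˡ X)) , (λ X → ≋⇒~ (neg-invʳ X))
            ; ⁻¹-cong = ~neg }
          ; comm = λ X Y → ≋⇒~ (+-comm X Y) }
        ; *-cong = ~*
        ; *-assoc = λ X Y Z → ≋⇒~ (*-assoc X Y Z)
        ; *-identity = (λ X → ≋⇒~ (*-idˡ X)) , (λ X → ≋⇒~ (*-idʳ X))
        ; distrib = (λ X Y Z → ≋⇒~ (*-distribˡ X Y Z)) , (λ X Y Z → ≋⇒~ (*-distribʳ Y Z X)) }
      ; *-comm = λ X Y → ≋⇒~ (*-comm X Y) } }

  cst-homomorphism/M : ℤ.+-*-rawRing -Raw-AlmostCommutative⟶ fromCommutativeRing ℤ[q]/M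
  cst-homomorphism/M = record
    { ⟦_⟧ = cst
    ; +-homo = λ a b → ≋⇒~ (+-homo a b)
    ; *-homo = λ a b → ≋⇒~ (*-homo a b)
    ; -‿homo = λ a → ≋⇒~ (-‿homo a)
    ; 0-homo = ≋⇒~ 0-homo
    ; 1-homo = ~-refl }
    where open _-Raw-AlmostCommutative⟶_ cst-homomorphism

  cst-equal?/M : ∀ a b → Maybe (cst a ~ cst b)
  cst-equal?/M a b with cst-equal? a b
  ... | just e = just (≋⇒~ e)
  ... | nothing = nothing

  open RingSolver ℤ.+-*-rawRing (fromCommutativeRing ℤ[q]/M) cst-homomorphism/M cst-equal?/M public
    using (solve; _:+_; _:*_; _:-_; :-_; _:=_; con)
  module ~-Reasoning = Relation.Binary.Reasoning.Setoid (CommutativeRing.setoid ℤ[q]/M)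

  multiple≡0 : ∀ A → (M *P A) ~ []
  multiple≡0 A = mk~ A (+-idʳ (M *P A))

  modulus≡0 : M ~ []
  modulus≡0 = mk~ oneP (≋-trans (+-idʳ M) (≋-sym (*-idʳ M)))

  ~0⇒∣ : ∀ {X} → X ~ [] → M ∣P X
  ~0⇒∣ {X} (mk~ w e) = w , at (≋-trans (≋-sym (+-idʳ X)) e)

  cst0≡0 : cst (+ 0) ~ []
  cst0≡0 = ≋⇒~ (mk≋ λ { zero → refl ; (suc n) → refl })

  pow-cong : ∀ {X Y} d → X ~ Y → (X ^P d) ~ (Y ^P d)
  pow-cong zero e = ~-refl
  pow-cong (suc d) e = ~* e (pow-cong d e)

  pow-one : ∀ d → (oneP ^P d) ~ oneP
  pow-one zero = ~-refl
  pow-one (suc d) = ~-trans (≋⇒~ (*-idˡ _)) (pow-one d)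

  pow-* : ∀ X Y d → ((X *P Y) ^P d) ~ (X ^P d *P Y ^P d)
  pow-* X Y zero = ≋⇒~ (≋-sym (*-idˡ oneP))
  pow-* X Y (suc d) = ~-trans (~* (~-refl {X *P Y}) (pow-* X Y d))
    (solve 4 (λ X Y A B → (X :* Y) :* (A :* B) := (X :* A) :* (Y :* B)) ~-refl X Y (X ^P d) (Y ^P d))

  pow-+ : ∀ X m n → (X ^P (m + n)) ~ (X ^P m *P X ^P n)
  pow-+ X zero n = ≋⇒~ (≋-sym (*-idˡ _))
  pow-+ X (suc m) n = ~-trans (~* (~-refl {X}) (pow-+ X m n))
    (solve 3 (λ X A B → X :* (A :* B) := (X :* A) :* B) ~-refl X (X ^P m) (X ^P n))

  pow-neg : ∀ X d → ((-P X) ^P d) ~ (cst (sgn d) *P X ^P d)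
  pow-neg X zero = ≋⇒~ (≋-sym (*-idˡ oneP))
  pow-neg X (suc d) = ~-trans (~* (~-refl { -P X}) (pow-neg X d))
    (~-trans (solve 3 (λ X s A → (:- X) :* (s :* A) := (:- s) :* (X :* A)) ~-refl X (cst (sgn d)) (X ^P d))
             (~* (~-sym (≋⇒~ (_-Raw-AlmostCommutative⟶_.-‿homo cst-homomorphism (sgn d)))) ~-refl))

  binomial : ∀ Z d → (Z *P Z) ~ [] → ((oneP +P Z) ^P d) ~ (oneP +P cst (+ d) *P Z)
  binomial Z zero Z²≡0 = solve 1 (λ Z → con (+ 1) := con (+ 1) :+ con (+ 0) :* Z) ~-refl Z
  binomial Z (suc d) Z²≡0 = begin
      (oneP +P Z) *P ((oneP +P Z) ^P d)
        ≈⟨ ~* (~-refl {oneP +P Z}) (binomial Z d Z²≡0) ⟩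
      (oneP +P Z) *P (oneP +P cst (+ d) *P Z)
        ≈⟨ solve 2 (λ Z D → (con (+ 1) :+ Z) :* (con (+ 1) :+ D :* Z)
                            := con (+ 1) :+ (con (+ 1) :+ D) :* Z :+ D :* (Z :* Z)) ~-refl Z (cst (+ d)) ⟩
      oneP +P (oneP +P cst (+ d)) *P Z +P cst (+ d) *P (Z *P Z)
        ≈⟨ ~+ (~-refl {oneP +P (oneP +P cst (+ d)) *P Z}) (~* (~-refl {cst (+ d)}) (~-trans Z²≡0 (~-sym cst0≡0))) ⟩
      oneP +P (oneP +P cst (+ d)) *P Z +P cst (+ d) *P cst (+ 0)
        ≈⟨ solve 2 (λ Z D → con (+ 1) :+ (con (+ 1) :+ D) :* Z :+ D :* con (+ 0)
                            := con (+ 1) :+ (con (+ 1) :+ D) :* Z) ~-refl Z (cst (+ d)) ⟩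
      oneP +P cst (+ suc d) *P Z ∎
    where open ~-Reasoning

  inverse-unique : ∀ {D U W} → (D *P U) ~ oneP → (D *P W) ~ oneP → U ~ W
  inverse-unique {D} {U} {W} DU≡1 DW≡1 = begin
      U                    ≈⟨ solve 1 (λ U → U := U :* con (+ 1)) ~-refl U ⟩
      U *P oneP            ≈⟨ ~* (~-refl {U}) (~-sym DW≡1) ⟩
      U *P (D *P W)        ≈⟨ solve 3 (λ U D W → U :* (D :* W) := (D :* U) :* W) ~-refl U D W ⟩
      (D *P U) *P W        ≈⟨ ~* DU≡1 (~-refl {W}) ⟩
      oneP *P W            ≈⟨ ≋⇒~ (*-idˡ W) ⟩
      W                    ∎
    where open ~-Reasoning

  unit-* : ∀ {A B} → Unit A → Unit B → Unit (A *P B)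
  unit-* {A} {B} (mkUnit U AU≡1) (mkUnit V BV≡1) = mkUnit (U *P V)
    (~-trans (solve 4 (λ A U B V → (A :* B) :* (U :* V) := (A :* U) :* (B :* V)) ~-refl A U B V)
    (~-trans (~* AU≡1 BV≡1) (≋⇒~ (*-idˡ oneP))))

  unit-pow : ∀ {A} e → Unit A → Unit (A ^P e)
  unit-pow {A} e u = mkUnit (inverse u ^P e)
    (~-trans (~-sym (pow-* A (inverse u) e)) (~-trans (pow-cong e (invertible u)) (pow-one e)))


sumP : (ℕ → Poly) → ℕ → Poly
sumP f zero = []
sumP f (suc n) = sumP f n +P f n

Σ1 : ℕ → (ℕ → Poly) → Poly
Σ1 n f = sumP (λ i → f (suc i)) n

Tri : ℕ → (ℕ → ℕ → Poly) → Poly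
Tri n h = Σ1 n (λ k → Σ1 (k ∸ 1) (λ j → h j k))

module Sums (M : Poly) where
  open Congruence M

  sum-cong : ∀ n {f g} → (∀ k → 1 ≤ k → k ≤ n → f k ~ g k) → Σ1 n f ~ Σ1 n g
  sum-cong zero f≡g = ~-refl
  sum-cong (suc n) f≡g =
    ~+ (sum-cong n (λ k 1≤k k≤n → f≡g k 1≤k (ℕP.m≤n⇒m≤1+n k≤n))) (f≡g (suc n) (s≤s z≤n) ℕP.≤-refl)

  sum-+ : ∀ n f g → Σ1 n (λ k → f k +P g k) ~ (Σ1 n f +P Σ1 n g)
  sum-+ zero f g = ~-refl
  sum-+ (suc n) f g = ~-trans (~+ (sum-+ n f g) ~-refl)
    (solve 4 (λ a b c d → (a :+ b) :+ (c :+ d) := (a :+ c) :+ (b :+ d)) ~-refl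
       (Σ1 n f) (Σ1 n g) (f (suc n)) (g (suc n)))

  sum-*ˡ : ∀ n c f → Σ1 n (λ k → c *P f k) ~ (c *P Σ1 n f)
  sum-*ˡ zero c f = ≋⇒~ (≋-sym (*-zeroʳ c))
  sum-*ˡ (suc n) c f = ~-trans (~+ (sum-*ˡ n c f) ~-refl)
    (solve 3 (λ c a b → c :* a :+ c :* b := c :* (a :+ b)) ~-refl c (Σ1 n f) (f (suc n)))

  sum-neg : ∀ n f → Σ1 n (λ k → -P f k) ~ (-P Σ1 n f)
  sum-neg zero f = ≋⇒~ (mk≋ λ _ → refl)
  sum-neg (suc n) f = ~-trans (~+ (sum-neg n f) ~-refl)
    (solve 2 (λ a b → :- a :+ :- b := :- (a :+ b)) ~-refl (Σ1 n f) (f (suc n)))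

  sum-front : ∀ n f → Σ1 (suc n) f ~ (f 1 +P Σ1 n (λ k → f (suc k)))
  sum-front zero f = ≋⇒~ (≋-sym (+-idʳ (f 1)))
  sum-front (suc n) f = ~-trans (~+ (sum-front n f) ~-refl)
    (solve 3 (λ a b c → (a :+ b) :+ c := a :+ (b :+ c)) ~-refl
       (f 1) (Σ1 n (λ k → f (suc k))) (f (suc (suc n))))

  sum-reverse : ∀ n f → Σ1 n f ~ Σ1 n (λ k → f (suc n ∸ k))
  sum-reverse zero f = ~-refl
  sum-reverse (suc n) f = begin
      Σ1 n f +P f (suc n)
        ≈⟨ ~+ (sum-reverse n f) ~-refl ⟩
      Σ1 n (λ k → f (suc n ∸ k)) +P f (suc n)
        ≈⟨ ≋⇒~ (+-comm (Σ1 n (λ k → f (suc n ∸ k))) (f (suc n))) ⟩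
      f (suc n) +P Σ1 n (λ k → f (suc n ∸ k))
        ≈⟨ ~-sym (sum-front n (λ k → f (suc (suc n) ∸ k))) ⟩
      Σ1 (suc n) (λ k → f (suc (suc n) ∸ k)) ∎
    where open ~-Reasoning

  tri-cong : ∀ n {h h'} → (∀ j k → 1 ≤ j → j < k → k ≤ n → h j k ~ h' j k) → Tri n h ~ Tri n h'
  tri-cong n {h} {h'} h≡h' = sum-cong n {λ k → Σ1 (k ∸ 1) (λ j → h j k)} {λ k → Σ1 (k ∸ 1) (λ j → h' j k)} λ
    { zero () _
    ; (suc k) _ k<n → sum-cong k (λ j 1≤j j≤k → h≡h' j (suc k) 1≤j (s≤s j≤k) k<n) }

  tri-+ : ∀ n h g → Tri n (λ j k → h j k +P g j k) ~ (Tri n h +P Tri n g)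
  tri-+ n h g = ~-trans (sum-cong n (λ k _ _ → sum-+ (k ∸ 1) (λ j → h j k) (λ j → g j k)))
                        (sum-+ n (λ k → Σ1 (k ∸ 1) (λ j → h j k)) (λ k → Σ1 (k ∸ 1) (λ j → g j k)))

  tri-reverse : ∀ n h → Tri n h ~ Tri n (λ j k → h (suc n ∸ k) (suc n ∸ j))
  tri-reverse zero h = ~-refl
  tri-reverse (suc n) h = begin
      Tri n h +P Σ1 n (λ j → h j (suc n))
        ≈⟨ ~+ (tri-reverse n h) (sum-reverse n (λ j → h j (suc n))) ⟩
      Tri n h' +P Σ1 n (λ k → h (suc n ∸ k) (suc n))
        ≈⟨ ≋⇒~ (+-comm (Tri n h') _) ⟩
      Σ1 n (λ k → h (suc n ∸ k) (suc n)) +P Tri n h'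
        ≈⟨ ~-sym (sum-+ n (λ k → h (suc n ∸ k) (suc n)) (λ k → Σ1 (k ∸ 1) (λ j → h' j k))) ⟩
      Σ1 n (λ k → h (suc n ∸ k) (suc n) +P Σ1 (k ∸ 1) (λ j → h' j k))
        ≈⟨ sum-cong n {λ k → h (suc n ∸ k) (suc n) +P Σ1 (k ∸ 1) (λ j → h' j k)}
                      {λ k → Σ1 k (λ j → h (suc n ∸ k) (suc (suc n) ∸ j))}
                      (λ { zero () _ ; (suc k) _ _ → ~-sym (sum-front k (λ j → h (n ∸ k) (suc (suc n) ∸ j))) }) ⟩
      Σ1 n (λ k → Σ1 k (λ j → h (suc n ∸ k) (suc (suc n) ∸ j)))
        ≈⟨ ~-sym (sum-front n (λ k → Σ1 (k ∸ 1) (λ j → h (suc (suc n) ∸ k) (suc (suc n) ∸ j)))) ⟩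
      Tri (suc n) (λ j k → h (suc (suc n) ∸ k) (suc (suc n) ∸ j)) ∎
    where
    open ~-Reasoning
    h' : ℕ → ℕ → Poly
    h' j k = h (suc n ∸ k) (suc n ∸ j)

  sum-product : ∀ n f g →
    (Σ1 n f *P Σ1 n g) ~ (Tri n (λ j k → f j *P g k +P f k *P g j) +P Σ1 n (λ k → f k *P g k))
  sum-product zero f g = ≋⇒~ (mk≋ λ _ → refl)
  sum-product (suc n) f g = begin
      (F +P f (suc n)) *P (G +P g (suc n))
        ≈⟨ solve 4 (λ F x G y → (F :+ x) :* (G :+ y) := F :* G :+ (F :* y :+ x :* G) :+ x :* y) ~-refl
             F (f (suc n)) G (g (suc n)) ⟩
      F *P G +P (F *P g (suc n) +P f (suc n) *P G) +P f (suc n) *P g (suc n)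
        ≈⟨ ~+ (~+ (sum-product n f g) (~-sym last-column)) ~-refl ⟩
      T +P D +P Σ1 n (λ j → f j *P g (suc n) +P f (suc n) *P g j) +P f (suc n) *P g (suc n)
        ≈⟨ solve 4 (λ T D C x → T :+ D :+ C :+ x := (T :+ C) :+ (D :+ x)) ~-refl
             T D (Σ1 n (λ j → f j *P g (suc n) +P f (suc n) *P g j)) (f (suc n) *P g (suc n)) ⟩
      (T +P Σ1 n (λ j → f j *P g (suc n) +P f (suc n) *P g j)) +P (D +P f (suc n) *P g (suc n)) ∎
    where
    open ~-Reasoning
    F G T D : Poly
    F = Σ1 n f
    G = Σ1 n g
    T = Tri n (λ j k → f j *P g k +P f k *P g j)
    D = Σ1 n (λ k → f k *P g k)
    last-column : Σ1 n (λ j → f j *P g (suc n) +P f (suc n) *P g j) ~ (F *P g (suc n) +P f (suc n) *P G)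
    last-column = ~-trans (sum-+ n (λ j → f j *P g (suc n)) (λ j → f (suc n) *P g j))
      (~+ (~-trans (sum-cong n (λ k _ _ → ≋⇒~ (*-comm (f k) (g (suc n)))))
          (~-trans (sum-*ˡ n (g (suc n)) f) (≋⇒~ (*-comm (g (suc n)) F))))
          (sum-*ˡ n (f (suc n)) g))

module QIdentities where
  open ℤ[q]-Solver

  qPow-+ : ∀ m n → qPow (m + n) ≋ (qPow m *P qPow n)
  qPow-+ zero n = ≋-sym (*-idˡ (qPow n))
  qPow-+ (suc m) n = ≋-trans (shift-≋ (qPow-+ m n)) (≋-sym (shift-*ˡ (qPow m) (qPow n)))

  qPow-* : ∀ b m → qPow (b * m) ≋ (qPow m ^P b)
  qPow-* zero m = ≋-refl
  qPow-* (suc b) m = ≋-trans (qPow-+ m (b * m)) (*-congʳ (qPow m) (qPow-* b m))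

  qInt-+ : ∀ m n → qInt (m + n) ≋ (qInt m +P qPow m *P qInt n)
  qInt-+ zero n = ≋-sym (*-idˡ (qInt n))
  qInt-+ (suc m) n = ≋-trans (∷-≋ refl (qInt-+ m n))
    (≋-sym (+-cong (≋-refl {qInt (suc m)}) (shift-*ˡ (qPow m) (qInt n))))

  geom : ℕ → ℕ → Poly
  geom m zero = []
  geom m (suc x) = oneP +P qPow m *P geom m x

  qInt-* : ∀ x m → qInt (x * m) ≋ (qInt m *P geom m x)
  qInt-* zero m = ≋-sym (*-zeroʳ (qInt m))
  qInt-* (suc x) m = ≋-trans (qInt-+ m (x * m))
    (≋-trans (+-cong (≋-refl {qInt m}) (*-congʳ (qPow m) (qInt-* x m)))
    (solve 3 (λ I Q G → I :+ Q :* (I :* G) := I :* (con (+ 1) :+ Q :* G)) ≋-refl (qInt m) (qPow m) (geom m x)))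

  qPow-via-qInt : ∀ n → qPow n ≋ (oneP -P (oneP -P qPow 1) *P qInt n)
  qPow-via-qInt zero = ≋-sym (≋-trans (+-cong (≋-refl {oneP}) (-‿cong (*-zeroʳ (oneP -P qPow 1)))) (+-idʳ oneP))
  qPow-via-qInt (suc n) =
    ≋-trans (≋-trans (qPow-+ 1 n) (*-congʳ (qPow 1) (qPow-via-qInt n)))
    (≋-trans (solve 2 (λ q I → q :* (con (+ 1) :- (con (+ 1) :- q) :* I)
                              := con (+ 1) :- (con (+ 1) :- q) :* (con (+ 1) :+ q :* I)) ≋-refl (qPow 1) (qInt n))
    (+-cong (≋-refl {oneP}) (-‿cong (*-congʳ (oneP -P qPow 1) (≋-sym (qInt-+ 1 n))))))

open QIdentities

-- Arithmetic modulo a divisor M of [p]: q^p ≡ 1, and [m] is a unit whenever p ∤ m.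

module ModuloDivisorOfQInt (p : ℕ) (M : Poly) ([p]≡0 : Congruence._~_ M (qInt p) []) where
  open Congruence M

  [p]≡cst0 : qInt p ~ cst (+ 0)
  [p]≡cst0 = ~-trans [p]≡0 (~-sym cst0≡0)

  qPow-p≡1 : qPow p ~ oneP
  qPow-p≡1 = begin
      qPow p
        ≈⟨ ≋⇒~ (qPow-via-qInt p) ⟩
      oneP -P (oneP -P qPow 1) *P qInt p
        ≈⟨ ~+ (~-refl {oneP}) (~neg (~* (~-refl {oneP -P qPow 1}) [p]≡cst0)) ⟩
      oneP -P (oneP -P qPow 1) *P cst (+ 0)
        ≈⟨ solve 1 (λ X → con (+ 1) :- X :* con (+ 0) := con (+ 1)) ~-refl (oneP -P qPow 1) ⟩
      oneP ∎
    where open ~-Reasoning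

  qPow-multiple≡1 : ∀ b → qPow (b * p) ~ oneP
  qPow-multiple≡1 b = ~-trans (≋⇒~ (qPow-* b p)) (~-trans (pow-cong b qPow-p≡1) (pow-one b))

  geom≡count : ∀ a → geom p a ~ cst (+ a)
  geom≡count zero = ~-sym cst0≡0
  geom≡count (suc a) = ~-trans (~+ (~-refl {oneP}) (~* qPow-p≡1 (geom≡count a)))
                               (≋⇒~ (+-cong (≋-refl {oneP}) (*-idˡ (cst (+ a)))))

  qInt-1+xm : ∀ x m → qInt (1 + x * m) ≋ (oneP +P qPow 1 *P (qInt m *P geom m x))
  qInt-1+xm x m = ≋-trans (qInt-+ 1 (x * m)) (+-cong (≋-refl {oneP}) (*-congʳ (qPow 1) (qInt-* x m)))

  -- A Bézout identity 1 + y p = x m gives [m] · geom m x = [x m] = 1 + q [p] geom p y ≡ 1, and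
  -- 1 + x m = y p gives [m] · (− q geom m x) = 1 − [1 + x m] = 1 − [p] geom p y ≡ 1.
  qInt-unit : ∀ {m} → Coprime m p → Unit (qInt m)
  qInt-unit {m} m⊥p with coprime-Bézout m⊥p
  ... | Bézout.+- x y 1+yp≡xm = mkUnit (geom m x) (begin
      qInt m *P geom m x
        ≈⟨ ≋⇒~ (≋-sym (qInt-* x m)) ⟩
      qInt (x * m)
        ≈⟨ ≋⇒~ (≋-trans (≡⇒≋ (cong qInt (sym 1+yp≡xm))) (qInt-1+xm y p)) ⟩
      oneP +P qPow 1 *P (qInt p *P geom p y)
        ≈⟨ ~+ (~-refl {oneP}) (~* (~-refl {qPow 1}) (~* [p]≡cst0 (~-refl {geom p y}))) ⟩
      oneP +P qPow 1 *P (cst (+ 0) *P geom p y)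
        ≈⟨ solve 2 (λ Q G → con (+ 1) :+ Q :* (con (+ 0) :* G) := con (+ 1)) ~-refl (qPow 1) (geom p y) ⟩
      oneP ∎)
    where open ~-Reasoning
  ... | Bézout.-+ x y 1+xm≡yp = mkUnit (-P (qPow 1 *P geom m x)) (begin
      qInt m *P (-P (qPow 1 *P geom m x))
        ≈⟨ solve 3 (λ I Q G → I :* (:- (Q :* G)) := con (+ 1) :- (con (+ 1) :+ Q :* (I :* G))) ~-refl
             (qInt m) (qPow 1) (geom m x) ⟩
      oneP -P (oneP +P qPow 1 *P (qInt m *P geom m x))
        ≈⟨ ≋⇒~ (+-cong (≋-refl {oneP})
                       (-‿cong (≋-trans (≋-sym (qInt-1+xm x m)) (≡⇒≋ (cong qInt 1+xm≡yp))))) ⟩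
      oneP -P qInt (y * p)
        ≈⟨ ~+ (~-refl {oneP}) (~neg (~-trans (≋⇒~ (qInt-* y p)) (~* [p]≡cst0 (~-refl {geom p y})))) ⟩
      oneP -P cst (+ 0) *P geom p y
        ≈⟨ solve 1 (λ G → con (+ 1) :- con (+ 0) :* G := con (+ 1)) ~-refl (geom p y) ⟩
      oneP ∎)
    where open ~-Reasoning

  -- A total choice of inverse: [m]⁻¹ when m is prime to p, and 1 otherwise.
  qInt-inverse : ℕ → Poly
  qInt-inverse m with Coprimality.coprime? m p
  ... | yes m⊥p = inverse (qInt-unit m⊥p)
  ... | no _ = oneP

  qInt-inverse-correct : ∀ {m} → Coprime m p → (qInt m *P qInt-inverse m) ~ oneP
  qInt-inverse-correct {m} m⊥p with Coprimality.coprime? m p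
  ... | yes m⊥p′ = invertible (qInt-unit m⊥p′)
  ... | no ¬m⊥p = ⊥-elim (¬m⊥p m⊥p)

-- The reflection lemma: the inverse of [n − m] in terms of the inverse of [m]

module Reflection (M : Poly) where
  open Congruence M

  -- If m + m' = n, [n]² ≡ 0 and U, U' invert [m], [m'], then U' ≡ −q^m U (1 + [n] U):
  -- since q^m [m'] = [n] − [m], the right-hand side times [m'] is ([m]U − [n]U)(1 + [n]U) ≡ 1.
  complement-inverse : ∀ {m m' n U U'} → m + m' ≡ n → (qInt n *P qInt n) ~ cst (+ 0) →
    (qInt m *P U) ~ oneP → (qInt m' *P U') ~ oneP →
    U' ~ (-P (qPow m *P (U *P (oneP +P qInt n *P U))))
  complement-inverse {m} {m'} {n} {U} {U'} m+m'≡n [n]²≡0 [m]U≡1 [m']U'≡1 =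
    inverse-unique {qInt m'} [m']U'≡1 (begin
      qInt m' *P (-P (Q *P (U *P L)))
        ≈⟨ solve 4 (λ I Q U L → I :* (:- (Q :* (U :* L))) := :- ((Q :* I) :* (U :* L))) ~-refl
             (qInt m') Q U L ⟩
      -P ((Q *P qInt m') *P (U *P L))
        ≈⟨ ~neg (~* complement (~-refl {U *P L})) ⟩
      -P ((N -P qInt m) *P (U *P L))
        ≈⟨ solve 3 (λ N I U → :- ((N :- I) :* (U :* (con (+ 1) :+ N :* U)))
                             := (I :* U) :* (con (+ 1) :+ N :* U) :- N :* U :- (N :* N) :* (U :* U)) ~-refl N (qInt m) U ⟩
      (qInt m *P U) *P L -P N *P U -P (N *P N) *P (U *P U)
        ≈⟨ ~+ (~+ (~* [m]U≡1 (~-refl {L})) (~-refl { -P (N *P U)})) (~neg (~* [n]²≡0 (~-refl {U *P U}))) ⟩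
      oneP *P L -P N *P U -P cst (+ 0) *P (U *P U)
        ≈⟨ solve 2 (λ N U → con (+ 1) :* (con (+ 1) :+ N :* U) :- N :* U :- con (+ 0) :* (U :* U) := con (+ 1))
             ~-refl N U ⟩
      oneP ∎)
    where
    open ~-Reasoning
    N Q L : Poly
    N = qInt n
    Q = qPow m
    L = oneP +P N *P U
    complement : (Q *P qInt m') ~ (N -P qInt m)
    complement = ~-trans (solve 2 (λ I X → X := (I :+ X) :- I) ~-refl (qInt m) (Q *P qInt m'))
      (≋⇒~ (+-cong (≋-sym (≋-trans (≡⇒≋ (cong qInt (sym m+m'≡n))) (qInt-+ m m'))) (≋-refl { -P qInt m})))

  -- Raising to the d-th power, with ([n]U)² ≡ 0:  U'^d ≡ (−1)^d q^{dm} U^d (1 + d [n] U).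
  complement-inverse-pow : ∀ {m m' n U U'} d → m + m' ≡ n → (qInt n *P qInt n) ~ cst (+ 0) →
    (qInt m *P U) ~ oneP → (qInt m' *P U') ~ oneP →
    (U' ^P d) ~ (cst (sgn d) *P (qPow (d * m) *P (U ^P d *P (oneP +P cst (+ d) *P (qInt n *P U)))))
  complement-inverse-pow {m} {m'} {n} {U} {U'} d m+m'≡n [n]²≡0 [m]U≡1 [m']U'≡1 = begin
      U' ^P d
        ≈⟨ pow-cong d (complement-inverse {m} {m'} {n} {U} {U'} m+m'≡n [n]²≡0 [m]U≡1 [m']U'≡1) ⟩
      (-P (qPow m *P (U *P (oneP +P Z)))) ^P d
        ≈⟨ pow-neg (qPow m *P (U *P (oneP +P Z))) d ⟩
      cst (sgn d) *P (qPow m *P (U *P (oneP +P Z))) ^P d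
        ≈⟨ ~* (~-refl {cst (sgn d)})
              (~-trans (pow-* (qPow m) _ d) (~* (~-refl {qPow m ^P d}) (pow-* U (oneP +P Z) d))) ⟩
      cst (sgn d) *P (qPow m ^P d *P (U ^P d *P (oneP +P Z) ^P d))
        ≈⟨ ~* (~-refl {cst (sgn d)})
              (~* (≋⇒~ (≋-sym (qPow-* d m))) (~* (~-refl {U ^P d}) (binomial Z d Z²≡0))) ⟩
      cst (sgn d) *P (qPow (d * m) *P (U ^P d *P (oneP +P cst (+ d) *P Z))) ∎
    where
    open ~-Reasoning
    Z : Poly
    Z = qInt n *P U
    Z²≡0 : (Z *P Z) ~ []
    Z²≡0 = ~-trans (solve 2 (λ N U → (N :* U) :* (N :* U) := (N :* N) :* (U :* U)) ~-refl (qInt n) U)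
           (~-trans (~* [n]²≡0 (~-refl {U *P U}))
           (~-trans (solve 1 (λ X → con (+ 0) :* X := con (+ 0)) ~-refl (U *P U)) cst0≡0))

module Fractions (M : Poly) where
  open Congruence M

  record Reduces (x : Frac) (r : Poly) : Set where
    constructor reduces
    field
      den-unit : Unit (den x)
      num≡ : num x ~ (r *P den x)

  one-unit : Unit oneP
  one-unit = mkUnit oneP (≋⇒~ (*-idˡ oneP))

  reduces-quotient : ∀ {A B D} → A ~ B → (u : Unit D) → Reduces (A / D) (B *P inverse u)
  reduces-quotient {A} {B} {D} A≡B u = reduces u (begin
      A                          ≈⟨ A≡B ⟩
      B                          ≈⟨ solve 1 (λ B → B := B :* con (+ 1)) ~-refl B ⟩
      B *P oneP                  ≈⟨ ~* (~-refl {B}) (~-sym (invertible u)) ⟩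
      B *P (D *P inverse u)      ≈⟨ solve 3 (λ B D U → B :* (D :* U) := (B :* U) :* D) ~-refl B D (inverse u) ⟩
      (B *P inverse u) *P D      ∎)
    where open ~-Reasoning

  reduces-poly : ∀ P → Reduces (polyF P) P
  reduces-poly P = reduces one-unit (≋⇒~ (≋-sym (*-idʳ P)))

  reduces-+ : ∀ {x y r s} → Reduces x r → Reduces y s → Reduces (x +F y) (r +P s)
  reduces-+ {a / b} {c / d} {r} {s} (reduces ub a≡rb) (reduces ud c≡sd) = reduces (unit-* ub ud)
    (~-trans (~+ (~* a≡rb (~-refl {d})) (~* c≡sd (~-refl {b})))
      (solve 4 (λ r b s d → r :* b :* d :+ s :* d :* b := (r :+ s) :* (b :* d)) ~-refl r b s d))

  reduces-* : ∀ {x y r s} → Reduces x r → Reduces y s → Reduces (x *F y) (r *P s)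
  reduces-* {a / b} {c / d} {r} {s} (reduces ub a≡rb) (reduces ud c≡sd) = reduces (unit-* ub ud)
    (~-trans (~* a≡rb c≡sd)
      (solve 4 (λ r b s d → (r :* b) :* (s :* d) := (r :* s) :* (b :* d)) ~-refl r b s d))

  reduces-neg : ∀ {x r} → Reduces x r → Reduces (-F x) (-P r)
  reduces-neg {a / b} {r} (reduces ub a≡rb) = reduces ub
    (~-trans (~neg a≡rb) (solve 2 (λ r b → :- (r :* b) := (:- r) :* b) ~-refl r b))

  reduces-- : ∀ {x y r s} → Reduces x r → Reduces y s → Reduces (x -F y) (r -P s)
  reduces-- rx sy = reduces-+ rx (reduces-neg sy)

  reduces-sum : ∀ n {f g} → (∀ k → 1 ≤ k → k ≤ n → Reduces (f k) (g k)) → Reduces (Σ1to n f) (Σ1 n g)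
  reduces-sum zero fg = reduces one-unit (≋⇒~ (mk≋ λ _ → refl))
  reduces-sum (suc n) fg =
    reduces-+ (reduces-sum n (λ k 1≤k k≤n → fg k 1≤k (ℕP.m≤n⇒m≤1+n k≤n))) (fg (suc n) (s≤s z≤n) ℕP.≤-refl)

  reduces⇒congruent : ∀ {x y r s} → Reduces x r → Reduces y s → r ~ s →
    CoprimeP (den x) M × CoprimeP (den y) M × (M ∣P ((num x *P den y) -P (num y *P den x)))
  reduces⇒congruent {a / b} {c / d} {r} {s} (reduces ub a≡rb) (reduces ud c≡sd) r≡s =
    unit⇒coprime ub , unit⇒coprime ud , ~0⇒∣ (begin
      a *P d -P c *P b                    ≈⟨ ~+ (~* a≡rb (~-refl {d})) (~neg (~* c≡sd (~-refl {b}))) ⟩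
      (r *P b) *P d -P (s *P d) *P b      ≈⟨ ~+ (~* (~* r≡s (~-refl {b})) (~-refl {d})) (~-refl { -P ((s *P d) *P b)}) ⟩
      (s *P b) *P d -P (s *P d) *P b      ≈⟨ solve 3 (λ s b d → s :* b :* d :- s :* d :* b := con (+ 0)) ~-refl s b d ⟩
      cst (+ 0)                           ≈⟨ cst0≡0 ⟩
      []                                  ∎)
    where open ~-Reasoning

coprime-to-power : ∀ N r D → CoprimeP D (N ^P suc r) → CoprimeP D N
coprime-to-power N r D D⊥Nʳ G G∣D (B , N≈GB) = D⊥Nʳ G G∣D (B *P N ^P r , at N·Nʳ≈G·BNʳ)
  where
  N·Nʳ≈G·BNʳ : (N *P N ^P r) ≋ (G *P (B *P N ^P r))
  N·Nʳ≈G·BNʳ = ≋-trans (*-congˡ (N ^P r) (mk≋ {N} {G *P B} N≈GB)) (*-assoc G B (N ^P r))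

congF-intro : ∀ p r {x y a b} → Fractions.Reduces (qInt p ^P suc r) x a → Fractions.Reduces (qInt p ^P suc r) y b →
  Congruence._~_ (qInt p ^P suc r) a b → CongF p (suc r) x y
congF-intro p r {x} {y} rx ry a≡b =
  coprime-to-power (qInt p) r (den x) (proj₁ congruent) ,
  coprime-to-power (qInt p) r (den y) (proj₁ (proj₂ congruent)) ,
  proj₂ (proj₂ congruent)
  where congruent = Fractions.reduces⇒congruent (qInt p ^P suc r) rx ry a≡b

sgn-+ : ∀ m n → sgn (m + n) ≡ sgn m *ℤ sgn n
sgn-+ zero n = sym (ℤP.*-identityˡ _)
sgn-+ (suc m) n = trans (cong ℤ.-_ (sgn-+ m n)) (ℤP.neg-distribˡ-* (sgn m) (sgn n))

sgn-square : ∀ d → sgn d *ℤ sgn d ≡ + 1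
sgn-square zero = refl
sgn-square (suc d) =
  trans (sym (ℤP.neg-distribˡ-* (sgn d) (ℤ.- sgn d)))
  (trans (cong ℤ.-_ (sym (ℤP.neg-distribʳ-* (sgn d) (sgn d)))) (trans (ℤP.neg-involutive _) (sgn-square d)))

sgn-pred : ∀ d → 0 < d → sgn d *ℤ sgn (d ∸ 1) ≡ ℤ.- + 1
sgn-pred (suc d) _ = trans (sym (ℤP.neg-distribˡ-* (sgn d) (sgn d))) (cong ℤ.-_ (sgn-square d))

sgn-complement : ∀ p k → sgn p ≡ ℤ.-1ℤ → k ≤ p → sgn (p ∸ k) ≡ ℤ.- sgn k
sgn-complement p k sgn-p k≤p = begin
    s                   ≡⟨ ℤP.*-identityʳ s ⟨
    s *ℤ + 1            ≡⟨ cong (s *ℤ_) (sgn-square k) ⟨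
    s *ℤ (t *ℤ t)       ≡⟨ ℤP.*-assoc s t t ⟨
    (s *ℤ t) *ℤ t       ≡⟨ cong (_*ℤ t) (trans (sym (sgn-+ (p ∸ k) k))
                                              (trans (cong sgn (ℕP.m∸n+n≡m k≤p)) sgn-p)) ⟩
    ℤ.-1ℤ *ℤ t          ≡⟨ ℤP.-1*i≡-i t ⟩
    ℤ.- t               ∎
  where
  open Eq.≡-Reasoning
  s t : ℤ
  s = sgn (p ∸ k)
  t = sgn k

halve : ∀ m → Σ ℕ (λ h → m ≡ h + h) ⊎ Σ ℕ (λ h → m ≡ suc (h + h))
halve zero = inj₁ (0 , refl)
halve (suc m) with halve m
... | inj₁ (h , m≡h+h) = inj₂ (h , cong suc m≡h+h)
... | inj₂ (h , m≡1+h+h) = inj₁ (suc h , trans (cong suc m≡1+h+h) (cong suc (sym (ℕP.+-suc h h))))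

even-prime : ∀ {p} h → Prime p → p ≡ h + h → 2 ≡ p
even-prime {p} h p-prime p≡h+h = [ (λ ()) , (λ 2≡p → 2≡p) ]′ (prime⇒irreducible p-prime 2∣p)
  where
  2∣p : 2 ∣ p
  2∣p = divides h (trans p≡h+h (trans (cong (λ z → h + z) (sym (ℕP.+-identityʳ h))) (ℕP.*-comm 2 h)))

sgn-odd-prime : ∀ p → Prime p → 2 < p → sgn p ≡ ℤ.-1ℤ
sgn-odd-prime p p-prime 2<p with halve p
... | inj₁ (h , p≡h+h) = ⊥-elim (ℕP.<-irrefl (even-prime h p-prime p≡h+h) 2<p)
... | inj₂ (h , p≡1+h+h) = trans (cong sgn p≡1+h+h) (cong ℤ.-_ (trans (sgn-+ h h) (sgn-square h)))

coprime-below-prime : ∀ {k p} → Prime p → 1 ≤ k → k < p → Coprime k p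
coprime-below-prime {suc k} p-prime _ k<p = Coprimality.sym (Coprimality.prime⇒coprime p-prime k<p)

coprime-* : ∀ {a k p} → Coprime a p → Coprime k p → Coprime (a * k) p
coprime-* {a} {k} {p} a⊥p k⊥p {i} (i∣ak , i∣p) = k⊥p (Coprimality.coprime-divisor i⊥a i∣ak , i∣p)
  where
  i⊥a : Coprime i a
  i⊥a (j∣i , j∣a) = a⊥p (j∣a , ∣-trans j∣i i∣p)

reflected-exponent : ∀ b b̄ k p e → e ≡ (b + b̄) * k → k ≤ p → b * (p ∸ k) + e ≡ b * p + b̄ * k
reflected-exponent b b̄ k p e e≡ k≤p = begin
    b * (p ∸ k) + e                  ≡⟨ cong (λ z → b * (p ∸ k) + z) e≡ ⟩
    b * (p ∸ k) + (b + b̄) * k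
      ≡⟨ ℕSolver.solve 4 (λ b x b̄ k → b :* x :+ (b :+ b̄) :* k := b :* (x :+ k) :+ b̄ :* k) refl b (p ∸ k) b̄ k ⟩
    b * ((p ∸ k) + k) + b̄ * k        ≡⟨ cong (λ z → b * z + b̄ * k) (ℕP.m∸n+n≡m k≤p) ⟩
    b * p + b̄ * k                    ∎
  where
  open Eq.≡-Reasoning
  open ℕSolver

positive-factor : ∀ a d → 0 < a * d → 0 < d
positive-factor a zero 0<a*0 = ⊥-elim (ℕP.<-irrefl (sym (ℕP.*-zeroʳ a)) 0<a*0)
positive-factor a (suc d) _ = s≤s z≤n

complement-lower : ∀ {n k} → k ≤ n → 1 ≤ suc n ∸ k
complement-lower k≤n = ℕP.m<n⇒0<n∸m (s≤s k≤n)

complement-upper : ∀ {n k} → 1 ≤ k → suc n ∸ k ≤ n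
complement-upper {n} {suc k} _ = ℕP.m∸n≤m n k

module SquareModulus (N : Poly) where
  module Mod¹ = Congruence N
  module Mod² = Congruence (N ^P 2)
  open ℤ[q]-Solver

  N²≋N·N : (N ^P 2) ≋ (N *P N)
  N²≋N·N = *-congʳ N (*-idʳ N)

  multiples-product≡0 : ∀ A B → Mod²._~_ ((N *P A) *P (N *P B)) (cst (+ 0))
  multiples-product≡0 A B = Mod².~-trans
    (Mod².≋⇒~ (≋-trans (solve 3 (λ N A B → (N :* A) :* (N :* B) := (N :* N) :* (A :* B)) ≋-refl N A B)
                       (*-congˡ (A *P B) (≋-sym N²≋N·N))))
    (Mod².~-trans (Mod².multiple≡0 (A *P B)) (Mod².~-sym Mod².cst0≡0))

  lift-multiple : ∀ {X Y} → Mod¹._~_ X Y → Mod²._~_ (N *P X) (N *P Y)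
  lift-multiple {X} {Y} (Mod¹.mk~ w X-Y≋Nw) = Mod².mk~ w
    (≋-trans (solve 3 (λ N X Y → N :* X :- N :* Y := N :* (X :- Y)) ≋-refl N X Y)
    (≋-trans (*-congʳ N X-Y≋Nw) (≋-trans (≋-sym (*-assoc N N w)) (*-congˡ w (≋-sym N²≋N·N)))))

  -- One Newton step: if D W ≡ 1 (mod N) then D · W(2 − D W) ≡ 1 (mod N²),
  -- because D W(2 − D W) − 1 = −(D W − 1)².
  newton : Poly → Poly → Poly
  newton D W = W *P (cst (+ 2) -P D *P W)

  newton-inverse : ∀ {D W} → Mod¹._~_ (D *P W) oneP → Mod²._~_ (D *P newton D W) oneP
  newton-inverse {D} {W} (Mod¹.mk~ w DW-1≋Nw) = Mod².mk~ (-P (w *P w))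
    (≋-trans (solve 2 (λ D W → D :* (W :* (con (+ 2) :- D :* W)) :- con (+ 1)
                           := :- ((D :* W :- con (+ 1)) :* (D :* W :- con (+ 1)))) ≋-refl D W)
    (≋-trans (-‿cong (*-cong DW-1≋Nw DW-1≋Nw))
    (≋-trans (solve 2 (λ N w → :- ((N :* w) :* (N :* w)) := (N :* N) :* (:- (w :* w))) ≋-refl N w)
             (*-congˡ (-P (w *P w)) (≋-sym N²≋N·N)))))

-- Part (i): modulo [p]², for p = n + 1 with (−1)^p = −1 and inverses U k of [a k]

module InversesModSquare (n : ℕ) (p-prime : Prime (suc n)) (a : ℕ) (a⊥p : Coprime a (suc n)) where
  open SquareModulus (qInt (suc n)) using (newton; newton-inverse)
  open ModuloDivisorOfQInt (suc n) (qInt (suc n)) (Congruence.modulus≡0 (qInt (suc n)))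
    using (qInt-inverse; qInt-inverse-correct)

  U : ℕ → Poly
  U k = newton (qInt (a * k)) (qInt-inverse (a * k))

  U-inverse : ∀ k → 1 ≤ k → k ≤ n → Congruence._~_ (qInt (suc n) ^P 2) (qInt (a * k) *P U k) oneP
  U-inverse k 1≤k k≤n = newton-inverse {qInt (a * k)}
    (qInt-inverse-correct (coprime-* a⊥p (coprime-below-prime p-prime 1≤k (s≤s k≤n))))


module PartI (n a b b̄ d : ℕ) (ad≡b+b̄ : a * d ≡ b + b̄) (0<d : 0 < d) (sgn-p : sgn (suc n) ≡ ℤ.-1ℤ)
             (U : ℕ → Poly)
             (U-inverse : ∀ k → 1 ≤ k → k ≤ n → Congruence._~_ (qInt (suc n) ^P 2) (qInt (a * k) *P U k) oneP)
             where
  p : ℕ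
  p = suc n

  N : Poly
  N = qInt p

  open Congruence (N ^P 2)
  open Sums (N ^P 2)
  open Fractions (N ^P 2)
  open SquareModulus N using (multiples-product≡0; lift-multiple)
  open ModuloDivisorOfQInt p N (Congruence.modulus≡0 N) using (geom≡count)
  open Reflection (N ^P 2) using (complement-inverse-pow)

  -- τ = (1 − q)[p], so that q^p = 1 − τ.
  τ : Poly
  τ = (oneP -P qPow 1) *P N

  -- [a p] = [p] · geom p a ≡ a [p] (mod [p]²), since geom p a ≡ a (mod [p]).
  qInt-ap≡aN : qInt (a * p) ~ (N *P cst (+ a))
  qInt-ap≡aN = ~-trans (≋⇒~ (qInt-* a p))
    (lift-multiple (geom≡count a))

  qInt-ap²≡0 : (qInt (a * p) *P qInt (a * p)) ~ cst (+ 0)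
  qInt-ap²≡0 = ~-trans (~* (≋⇒~ (qInt-* a p)) (≋⇒~ (qInt-* a p))) (multiples-product≡0 (geom p a) (geom p a))

  τ≋N·[1-q] : τ ≋ (N *P (oneP -P qPow 1))
  τ≋N·[1-q] = *-comm (oneP -P qPow 1) N

  τ·qInt-ap≡0 : (τ *P qInt (a * p)) ~ cst (+ 0)
  τ·qInt-ap≡0 = ~-trans (~* (≋⇒~ τ≋N·[1-q]) (≋⇒~ (qInt-* a p))) (multiples-product≡0 (oneP -P qPow 1) (geom p a))

  τ²≡0 : ((-P τ) *P (-P τ)) ~ []
  τ²≡0 = ~-trans (solve 1 (λ t → (:- t) :* (:- t) := t :* t) ~-refl τ)
    (~-trans (~* (≋⇒~ τ≋N·[1-q]) (≋⇒~ τ≋N·[1-q]))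
    (~-trans (multiples-product≡0 (oneP -P qPow 1) (oneP -P qPow 1)) cst0≡0))

  qPow-bp≡ : qPow (b * p) ~ (oneP +P cst (+ b) *P (-P τ))
  qPow-bp≡ = ~-trans (≋⇒~ (qPow-* b p)) (~-trans (pow-cong b (≋⇒~ (qPow-via-qInt p))) (binomial (-P τ) b τ²≡0))

  B AD : Poly
  B = cst (+ b)
  AD = (cst (+ a) *P cst (+ d)) *P N

  F : ℤ → ℕ → Poly
  F e k = cst e *P (qPow (b̄ * k) *P U k ^P d)

  -- The correction factor 1 + d [ap] U_k produced by the reflection lemma.
  L : ℕ → Poly
  L k = oneP +P cst (+ d) *P (qInt (a * p) *P U k)

  -- The reflected term, for (−1)^d c = −e:  c q^{b(p−k)} U_{p−k}^d ≡ −(1 − bτ) L_k F e k,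
  -- by the reflection lemma for [ak] + [a(p−k)] and q^{b(p−k)} q^{adk} = q^{bp} q^{b̄k}.
  reflected-term : ∀ k c e → 1 ≤ k → k ≤ n → sgn d *ℤ c ≡ ℤ.- e →
    (cst c *P (qPow (b * (p ∸ k)) *P U (p ∸ k) ^P d)) ~ (-P ((oneP +P cst (+ b) *P (-P τ)) *P (L k *P F e k)))
  reflected-term k c e 1≤k k≤n sign = begin
      cst c *P (Qr *P U (p ∸ k) ^P d)
        ≈⟨ ~* (~-refl {cst c}) (~* (~-refl {Qr}) reflected) ⟩
      cst c *P (Qr *P (cst (sgn d) *P (qPow (d * (a * k)) *P (U k ^P d *P L k))))
        ≈⟨ solve 6 (λ c Q s Q′ V L → c :* (Q :* (s :* (Q′ :* (V :* L)))) := (s :* c) :* ((Q :* Q′) :* (V :* L))) ~-refl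
             (cst c) Qr (cst (sgn d)) (qPow (d * (a * k))) (U k ^P d) (L k) ⟩
      (cst (sgn d) *P cst c) *P ((Qr *P qPow (d * (a * k))) *P (U k ^P d *P L k))
        ≈⟨ ~* (≋⇒~ sign-step)
              (~* (~-trans (≋⇒~ exponent) (~* qPow-bp≡ (~-refl {qPow (b̄ * k)}))) (~-refl {U k ^P d *P L k})) ⟩
      (-P cst e) *P ((R *P qPow (b̄ * k)) *P (U k ^P d *P L k))
        ≈⟨ solve 5 (λ E R X V L → (:- E) :* ((R :* X) :* (V :* L)) := :- (R :* (L :* (E :* (X :* V))))) ~-refl
             (cst e) R (qPow (b̄ * k)) (U k ^P d) (L k) ⟩
      -P (R *P (L k *P F e k)) ∎
    where
    open ~-Reasoning
    Qr R : Poly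
    Qr = qPow (b * (p ∸ k))
    R = oneP +P cst (+ b) *P (-P τ)
    k≤p : k ≤ p
    k≤p = ℕP.m≤n⇒m≤1+n k≤n
    reflected : (U (p ∸ k) ^P d) ~ (cst (sgn d) *P (qPow (d * (a * k)) *P (U k ^P d *P L k)))
    reflected = complement-inverse-pow {a * k} {a * (p ∸ k)} {a * p} d
      (trans (sym (ℕP.*-distribˡ-+ a k (p ∸ k))) (cong (a *_) (ℕP.m+[n∸m]≡n k≤p)))
      qInt-ap²≡0 (U-inverse k 1≤k k≤n) (U-inverse (p ∸ k) (complement-lower k≤n) (complement-upper 1≤k))
    exponent : (Qr *P qPow (d * (a * k))) ≋ (qPow (b * p) *P qPow (b̄ * k))
    exponent = ≋-trans (≋-sym (qPow-+ (b * (p ∸ k)) (d * (a * k))))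
      (≋-trans (≡⇒≋ (cong qPow (reflected-exponent b b̄ k p (d * (a * k)) dak≡ k≤p))) (qPow-+ (b * p) (b̄ * k)))
      where
      dak≡ : d * (a * k) ≡ (b + b̄) * k
      dak≡ = trans (sym (ℕP.*-assoc d a k)) (cong (_* k) (trans (ℕP.*-comm d a) ad≡b+b̄))
    sign-step : (cst (sgn d) *P cst c) ≋ (-P cst e)
    sign-step = ≋-trans (cst-* (sgn d) c)
      (≋-trans (≡⇒≋ (cong cst sign)) (_-Raw-AlmostCommutative⟶_.-‿homo cst-homomorphism e))

  -- Adding F e k and expanding, with [ap] ≡ a[p] and τ[ap] ≡ 0:
  --   c q^{b(p−k)} U_{p−k}^d + F e k ≡ bτ F e k − a d [p] F e k U_k.
  paired-terms : ∀ k c e → 1 ≤ k → k ≤ n → sgn d *ℤ c ≡ ℤ.- e →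
    (cst c *P (qPow (b * (p ∸ k)) *P U (p ∸ k) ^P d) +P F e k)
      ~ ((B *P τ) *P F e k -P AD *P (F e k *P U k))
  paired-terms k c e 1≤k k≤n sign = begin
      cst c *P (qPow (b * (p ∸ k)) *P U (p ∸ k) ^P d) +P F e k
        ≈⟨ ~+ (reflected-term k c e 1≤k k≤n sign) (~-refl {F e k}) ⟩
      -P ((oneP +P B *P (-P τ)) *P (L k *P F e k)) +P F e k
        ≈⟨ solve 6 (λ B t D Y u F → :- ((con (+ 1) :+ B :* (:- t)) :* ((con (+ 1) :+ D :* (Y :* u)) :* F)) :+ F
                                   := (B :* t) :* F :- (D :* Y) :* (F :* u) :+ (B :* D) :* ((t :* Y) :* (F :* u)))
             ~-refl B τ (cst (+ d)) (qInt (a * p)) (U k) (F e k) ⟩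
      (B *P τ) *P F e k -P (cst (+ d) *P qInt (a * p)) *P FU +P (B *P cst (+ d)) *P ((τ *P qInt (a * p)) *P FU)
        ≈⟨ ~+ (~+ (~-refl {(B *P τ) *P F e k}) (~neg (~* (~* (~-refl {cst (+ d)}) qInt-ap≡aN) (~-refl {FU}))))
              (~* (~-refl {B *P cst (+ d)}) (~* τ·qInt-ap≡0 (~-refl {FU}))) ⟩
      (B *P τ) *P F e k -P (cst (+ d) *P (N *P cst (+ a))) *P FU +P (B *P cst (+ d)) *P (cst (+ 0) *P FU)
        ≈⟨ solve 7 (λ B t F D N A X → (B :* t) :* F :- (D :* (N :* A)) :* X :+ (B :* D) :* (con (+ 0) :* X)
                                    := (B :* t) :* F :- ((A :* D) :* N) :* X)
             ~-refl B τ (F e k) (cst (+ d)) N (cst (+ a)) FU ⟩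
      (B *P τ) *P F e k -P AD *P FU ∎
    where
    open ~-Reasoning
    FU : Poly
    FU = F e k *P U k

  -- Summing over k, after reversing the order of the c-part of the sum:
  --   Σ (c_k q^{bk} + e_k q^{b̄k}) U_k^d ≡ bτ Σ e_k q^{b̄k} U_k^d − a d [p] Σ e_k q^{b̄k} U_k^{d+1}.
  sum-identity : ∀ (c e : ℕ → ℤ) → (∀ k → 1 ≤ k → k ≤ n → sgn d *ℤ c (p ∸ k) ≡ ℤ.- e k) →
    Σ1 n (λ k → (cst (c k) *P qPow (b * k) +P cst (e k) *P qPow (b̄ * k)) *P U k ^P d)
      ~ ((((+ b) •P τ) *P Σ1 n (λ k → (cst (e k) *P qPow (b̄ * k)) *P U k ^P d))
          -P (((+ (a * d)) •P N) *P Σ1 n (λ k → (cst (e k) *P qPow (b̄ * k)) *P U k ^P suc d)))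
  sum-identity c e sign = begin
      Σ1 n (λ k → (cst (c k) *P qPow (b * k) +P cst (e k) *P qPow (b̄ * k)) *P U k ^P d)
        ≈⟨ sum-cong n (λ k _ _ → solve 5 (λ c Q e Q' V → (c :* Q :+ e :* Q') :* V := c :* (Q :* V) :+ e :* (Q' :* V)) ~-refl
                                   (cst (c k)) (qPow (b * k)) (cst (e k)) (qPow (b̄ * k)) (U k ^P d)) ⟩
      Σ1 n (λ k → G k +P F (e k) k)
        ≈⟨ sum-+ n G (λ k → F (e k) k) ⟩
      Σ1 n G +P Σ1 n (λ k → F (e k) k)
        ≈⟨ ~+ (sum-reverse n G) (~-refl {Σ1 n (λ k → F (e k) k)}) ⟩
      Σ1 n (λ k → G (p ∸ k)) +P Σ1 n (λ k → F (e k) k)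
        ≈⟨ ~-sym (sum-+ n (λ k → G (p ∸ k)) (λ k → F (e k) k)) ⟩
      Σ1 n (λ k → G (p ∸ k) +P F (e k) k)
        ≈⟨ sum-cong n (λ k 1≤k k≤n → paired-terms k (c (p ∸ k)) (e k) 1≤k k≤n (sign k 1≤k k≤n)) ⟩
      Σ1 n (λ k → (B *P τ) *P F (e k) k -P AD *P (F (e k) k *P U k))
        ≈⟨ ~-trans (sum-+ n (λ k → (B *P τ) *P F (e k) k) (λ k → -P (AD *P (F (e k) k *P U k))))
                   (~+ (sum-*ˡ n (B *P τ) (λ k → F (e k) k))
                       (~-trans (sum-neg n (λ k → AD *P (F (e k) k *P U k))) (~neg (sum-*ˡ n AD (λ k → F (e k) k *P U k))))) ⟩
      (B *P τ) *P Σ1 n (λ k → F (e k) k) -P AD *P Σ1 n (λ k → F (e k) k *P U k)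
        ≈⟨ ~+ (~* (≋⇒~ (≋-sym (•-as-* (+ b) τ))) (sum-cong n (λ k _ _ → regroup-d k)))
              (~neg (~* (≋⇒~ AD≋ad•N) (sum-cong n (λ k _ _ → regroup-suc-d k)))) ⟩
      ((+ b) •P τ) *P Σ1 n (λ k → (cst (e k) *P qPow (b̄ * k)) *P U k ^P d)
        -P ((+ (a * d)) •P N) *P Σ1 n (λ k → (cst (e k) *P qPow (b̄ * k)) *P U k ^P suc d) ∎
    where
    open ~-Reasoning
    G : ℕ → Poly
    G k = cst (c k) *P (qPow (b * k) *P U k ^P d)
    AD≋ad•N : AD ≋ ((+ (a * d)) •P N)
    AD≋ad•N = ≋-trans (*-congˡ N (≋-trans (cst-* (+ a) (+ d)) (≡⇒≋ (cong cst (sym (ℤP.pos-* a d))))))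
                      (≋-sym (•-as-* (+ (a * d)) N))
    regroup-d : ∀ k → F (e k) k ~ ((cst (e k) *P qPow (b̄ * k)) *P U k ^P d)
    regroup-d k = solve 3 (λ e Q V → e :* (Q :* V) := (e :* Q) :* V) ~-refl (cst (e k)) (qPow (b̄ * k)) (U k ^P d)
    regroup-suc-d : ∀ k → (F (e k) k *P U k) ~ ((cst (e k) *P qPow (b̄ * k)) *P U k ^P suc d)
    regroup-suc-d k = solve 4 (λ e Q u V → (e :* (Q :* V)) :* u := (e :* Q) :* (u :* V)) ~-refl
                        (cst (e k)) (qPow (b̄ * k)) (U k) (U k ^P d)

  -- Part (i) for numerators T k ≡ c_k q^{bk} + e_k q^{b̄k} and E k ≡ e_k q^{b̄k}: every
  -- fraction reduces modulo [p]² through the inverses U k, and sum-identity compares them.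
  congruence-i : ∀ (T E : ℕ → Poly) (c e : ℕ → ℤ) →
    (∀ k → 1 ≤ k → k ≤ n → T k ~ (cst (c k) *P qPow (b * k) +P cst (e k) *P qPow (b̄ * k))) →
    (∀ k → 1 ≤ k → k ≤ n → E k ~ (cst (e k) *P qPow (b̄ * k))) →
    (∀ k → 1 ≤ k → k ≤ n → sgn d *ℤ c (p ∸ k) ≡ ℤ.- e k) →
    CongF p 2 (Σ1to n (λ k → T k / (qInt (a * k) ^P d)))
      ((polyF ((+ b) •P τ) *F Σ1to n (λ k → E k / (qInt (a * k) ^P d)))
        -F (polyF ((+ (a * d)) •P N) *F Σ1to n (λ k → E k / (qInt (a * k) ^P suc d))))
  congruence-i T E c e T≡ E≡ sign = congF-intro p 1
    (reduces-sum n (λ k 1≤k k≤n → reduces-term d k (T k) 1≤k k≤n (T≡ k 1≤k k≤n)))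
    (reduces-- (reduces-* (reduces-poly ((+ b) •P τ))
                          (reduces-sum n (λ k 1≤k k≤n → reduces-term d k (E k) 1≤k k≤n (E≡ k 1≤k k≤n))))
               (reduces-* (reduces-poly ((+ (a * d)) •P N))
                          (reduces-sum n (λ k 1≤k k≤n → reduces-term (suc d) k (E k) 1≤k k≤n (E≡ k 1≤k k≤n)))))
    (sum-identity c e sign)
    where
    reduces-term : ∀ j k X {Y} → 1 ≤ k → k ≤ n → X ~ Y → Reduces (X / (qInt (a * k) ^P j)) (Y *P U k ^P j)
    reduces-term j k X 1≤k k≤n X≡Y = reduces-quotient X≡Y (unit-pow j (mkUnit (U k) (U-inverse k 1≤k k≤n)))

  part-i : CongF p 2 (lhs1 p b b̄ a d) (rhs1 p b b̄ a d) × CongF p 2 (lhs2 p b b̄ a d) (rhs2 p b b̄ a d)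
  part-i =
    congruence-i (λ k → (sgn (d ∸ 1) •P qPow (b * k)) +P qPow (b̄ * k)) (λ k → qPow (b̄ * k))
      (λ _ → sgn (d ∸ 1)) (λ _ → + 1)
      (λ k _ _ → ≋⇒~ (+-cong (•-as-* (sgn (d ∸ 1)) (qPow (b * k))) (≋-sym (*-idˡ (qPow (b̄ * k))))))
      (λ k _ _ → ≋⇒~ (≋-sym (*-idˡ (qPow (b̄ * k)))))
      (λ k _ _ → sgn-pred d 0<d) ,
    congruence-i (λ k → sgn k •P ((sgn d •P qPow (b * k)) +P qPow (b̄ * k))) (λ k → sgn k •P qPow (b̄ * k))
      (λ k → sgn k *ℤ sgn d) sgn
      (λ k _ _ → alternating-numerator k)
      (λ k _ _ → ≋⇒~ (•-as-* (sgn k) (qPow (b̄ * k))))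
      alternating-sign
    where
    alternating-numerator : ∀ k → (sgn k •P ((sgn d •P qPow (b * k)) +P qPow (b̄ * k)))
                                  ~ (cst (sgn k *ℤ sgn d) *P qPow (b * k) +P cst (sgn k) *P qPow (b̄ * k))
    alternating-numerator k = begin
        sgn k •P ((sgn d •P Q) +P Q′)
          ≈⟨ ≋⇒~ (≋-trans (•-as-* (sgn k) _) (*-congʳ (cst (sgn k)) (+-cong (•-as-* (sgn d) Q) (≋-refl {Q′})))) ⟩
        cst (sgn k) *P (cst (sgn d) *P Q +P Q′)
          ≈⟨ solve 4 (λ s t Q Q′ → s :* (t :* Q :+ Q′) := (s :* t) :* Q :+ s :* Q′) ~-refl
               (cst (sgn k)) (cst (sgn d)) Q Q′ ⟩
        (cst (sgn k) *P cst (sgn d)) *P Q +P cst (sgn k) *P Q′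
          ≈⟨ ~+ (~* (≋⇒~ (cst-* (sgn k) (sgn d))) (~-refl {Q})) (~-refl {cst (sgn k) *P Q′}) ⟩
        cst (sgn k *ℤ sgn d) *P Q +P cst (sgn k) *P Q′ ∎
      where
      open ~-Reasoning
      Q Q′ : Poly
      Q = qPow (b * k)
      Q′ = qPow (b̄ * k)
    alternating-sign : ∀ k → 1 ≤ k → k ≤ n → sgn d *ℤ (sgn (p ∸ k) *ℤ sgn d) ≡ ℤ.- sgn k
    alternating-sign k _ k≤n = begin
        sgn d *ℤ (sgn (p ∸ k) *ℤ sgn d)   ≡⟨ trans (ℤP.*-comm (sgn d) _) (ℤP.*-assoc (sgn (p ∸ k)) (sgn d) (sgn d)) ⟩
        sgn (p ∸ k) *ℤ (sgn d *ℤ sgn d)   ≡⟨ cong (sgn (p ∸ k) *ℤ_) (sgn-square d) ⟩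
        sgn (p ∸ k) *ℤ + 1                ≡⟨ ℤP.*-identityʳ (sgn (p ∸ k)) ⟩
        sgn (p ∸ k)                       ≡⟨ sgn-complement p k sgn-p (ℕP.m≤n⇒m≤1+n k≤n) ⟩
        ℤ.- sgn k                         ∎
      where open Eq.≡-Reasoning

-- Part (ii): modulo [p], for p = n + 1 and inverses V j of [j]

qInt≡0-modulo-itself : ∀ p → Congruence._~_ (qInt p ^P 1) (qInt p) []
qInt≡0-modulo-itself p = ~-trans (≋⇒~ (≋-sym (*-idʳ (qInt p)))) modulus≡0
  where open Congruence (qInt p ^P 1)

module InversesModQInt (n : ℕ) (p-prime : Prime (suc n)) where
  open ModuloDivisorOfQInt (suc n) (qInt (suc n) ^P 1) (qInt≡0-modulo-itself (suc n))
    using (qInt-inverse; qInt-inverse-correct)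

  V : ℕ → Poly
  V = qInt-inverse

  V-inverse : ∀ j → 1 ≤ j → j ≤ n → Congruence._~_ (qInt (suc n) ^P 1) (qInt j *P V j) oneP
  V-inverse j 1≤j j≤n = qInt-inverse-correct (coprime-below-prime p-prime 1≤j (s≤s j≤n))

module PartII (n : ℕ) (V : ℕ → Poly)
              (V-inverse : ∀ j → 1 ≤ j → j ≤ n → Congruence._~_ (qInt (suc n) ^P 1) (qInt j *P V j) oneP)
              where
  p : ℕ
  p = suc n

  N : Poly
  N = qInt p

  open Congruence (N ^P 1)
  open Sums (N ^P 1)
  open Fractions (N ^P 1)
  open Reflection (N ^P 1) using (complement-inverse-pow)
  open ModuloDivisorOfQInt p (N ^P 1) (qInt≡0-modulo-itself p) using (qPow-multiple≡1)

  N≡cst0 : N ~ cst (+ 0)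
  N≡cst0 = ~-trans (qInt≡0-modulo-itself p) (~-sym cst0≡0)

  -- Modulo [p] the reflection j ↦ p − j exchanges q^{b j} V_j^d and (−1)^d q^{b̄ j} V_j^d,
  -- where d = b + b̄:  V_{p−j}^d ≡ (−1)^d q^{dj} V_j^d and q^{b(p−j)+dj} = q^{bp} q^{b̄j} ≡ q^{b̄j}.
  reflected-term : ∀ b b̄ j → 1 ≤ j → j ≤ n →
    (qPow (b * (p ∸ j)) *P V (p ∸ j) ^P (b + b̄)) ~ (cst (sgn (b + b̄)) *P (qPow (b̄ * j) *P V j ^P (b + b̄)))
  reflected-term b b̄ j 1≤j j≤n = begin
      Qr *P V (p ∸ j) ^P d
        ≈⟨ ~* (~-refl {Qr}) reflected ⟩
      Qr *P (cst (sgn d) *P (qPow (d * j) *P (V j ^P d *P L)))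
        ≈⟨ solve 5 (λ Q s Q′ W L → Q :* (s :* (Q′ :* (W :* L))) := s :* ((Q :* Q′) :* (W :* L))) ~-refl
             Qr (cst (sgn d)) (qPow (d * j)) (V j ^P d) L ⟩
      cst (sgn d) *P ((Qr *P qPow (d * j)) *P (V j ^P d *P L))
        ≈⟨ ~* (~-refl {cst (sgn d)})
              (~* (~-trans (≋⇒~ exponent) (~* (qPow-multiple≡1 b) (~-refl {qPow (b̄ * j)})))
                  (~* (~-refl {V j ^P d}) (~+ (~-refl {oneP}) (~* (~-refl {cst (+ d)}) (~* N≡cst0 (~-refl {V j})))))) ⟩
      cst (sgn d) *P ((oneP *P qPow (b̄ * j)) *P (V j ^P d *P (oneP +P cst (+ d) *P (cst (+ 0) *P V j))))
        ≈⟨ solve 5 (λ s Q W D v → s :* ((con (+ 1) :* Q) :* (W :* (con (+ 1) :+ D :* (con (+ 0) :* v))))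
                                 := s :* (Q :* W)) ~-refl
             (cst (sgn d)) (qPow (b̄ * j)) (V j ^P d) (cst (+ d)) (V j) ⟩
      cst (sgn d) *P (qPow (b̄ * j) *P V j ^P d) ∎
    where
    open ~-Reasoning
    d : ℕ
    d = b + b̄
    Qr L : Poly
    Qr = qPow (b * (p ∸ j))
    L = oneP +P cst (+ d) *P (N *P V j)
    j≤p : j ≤ p
    j≤p = ℕP.m≤n⇒m≤1+n j≤n
    reflected : (V (p ∸ j) ^P d) ~ (cst (sgn d) *P (qPow (d * j) *P (V j ^P d *P L)))
    reflected = complement-inverse-pow {j} {p ∸ j} {p} d (ℕP.m+[n∸m]≡n j≤p)
      (~-trans (~* N≡cst0 (~-refl {N})) (solve 1 (λ N → con (+ 0) :* N := con (+ 0)) ~-refl N))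
      (V-inverse j 1≤j j≤n) (V-inverse (p ∸ j) (complement-lower j≤n) (complement-upper 1≤j))
    exponent : (Qr *P qPow (d * j)) ≋ (qPow (b * p) *P qPow (b̄ * j))
    exponent = ≋-trans (≋-sym (qPow-+ (b * (p ∸ j)) (d * j)))
      (≋-trans (≡⇒≋ (cong qPow (reflected-exponent b b̄ j p (d * j) refl j≤p))) (qPow-+ (b * p) (b̄ * j)))

  module _ (b₁ b̄₁ b₂ b̄₂ : ℕ) where
    d₁ d₂ : ℕ
    d₁ = b₁ + b̄₁
    d₂ = b₂ + b̄₂

    A₁ Ā₁ A₂ Ā₂ : ℕ → Poly
    A₁ j = qPow (b₁ * j) *P V j ^P d₁
    Ā₁ j = qPow (b̄₁ * j) *P V j ^P d₁
    A₂ k = qPow (b₂ * k) *P V k ^P d₂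
    Ā₂ k = qPow (b̄₂ * k) *P V k ^P d₂

    s : Poly
    s = cst (sgn (d₁ + d₂))

    numerator : ℕ → ℕ → Poly
    numerator j k = qPow (b₁ * j + b₂ * k) +P (sgn (d₁ + d₂) •P qPow (b̄₁ * j + b̄₂ * k))

    lhs-reduced rhs-reduced : Poly
    lhs-reduced = Tri n (λ j k → numerator j k *P (V j ^P d₁ *P V k ^P d₂))
    rhs-reduced = (Σ1 n A₁ *P Σ1 n A₂) -P Σ1 n (λ k → qPow ((b₁ + b₂) * k) *P V k ^P (d₁ + d₂))

    lhs-split : lhs-reduced ~ (Tri n (λ j k → A₁ j *P A₂ k) +P Tri n (λ j k → s *P (Ā₁ j *P Ā₂ k)))
    lhs-split = ~-trans (tri-cong n (λ j k _ _ _ → summand j k))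
                        (tri-+ n (λ j k → A₁ j *P A₂ k) (λ j k → s *P (Ā₁ j *P Ā₂ k)))
      where
      summand : ∀ j k → (numerator j k *P (V j ^P d₁ *P V k ^P d₂)) ~ (A₁ j *P A₂ k +P s *P (Ā₁ j *P Ā₂ k))
      summand j k = ~-trans
        (~* (≋⇒~ (+-cong (qPow-+ (b₁ * j) (b₂ * k))
                         (≋-trans (•-as-* (sgn (d₁ + d₂)) _) (*-congʳ s (qPow-+ (b̄₁ * j) (b̄₂ * k))))))
            (~-refl {V j ^P d₁ *P V k ^P d₂}))
        (solve 7 (λ Q₁ Q₂ s R₁ R₂ W₁ W₂ → (Q₁ :* Q₂ :+ s :* (R₁ :* R₂)) :* (W₁ :* W₂)
                                        := (Q₁ :* W₁) :* (Q₂ :* W₂) :+ s :* ((R₁ :* W₁) :* (R₂ :* W₂)))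
           ~-refl (qPow (b₁ * j)) (qPow (b₂ * k)) s (qPow (b̄₁ * j)) (qPow (b̄₂ * k)) (V j ^P d₁) (V k ^P d₂))

    diagonal : ∀ k → (qPow ((b₁ + b₂) * k) *P V k ^P (d₁ + d₂)) ~ (A₁ k *P A₂ k)
    diagonal k = ~-trans
      (~* (≋⇒~ (≋-trans (≡⇒≋ (cong qPow (ℕP.*-distribʳ-+ k b₁ b₂))) (qPow-+ (b₁ * k) (b₂ * k))))
          (pow-+ (V k) d₁ d₂))
      (solve 4 (λ a b c d → (a :* b) :* (c :* d) := (a :* c) :* (b :* d)) ~-refl
         (qPow (b₁ * k)) (qPow (b₂ * k)) (V k ^P d₁) (V k ^P d₂))

    -- In the square of sums, the terms A₁ k A₂ j with j < k become s Ā₁ j Ā₂ k after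
    -- reflecting both indices.
    rhs-split : rhs-reduced ~ (Tri n (λ j k → A₁ j *P A₂ k) +P Tri n (λ j k → s *P (Ā₁ j *P Ā₂ k)))
    rhs-split = begin
        (Σ1 n A₁ *P Σ1 n A₂) -P Σ1 n (λ k → qPow ((b₁ + b₂) * k) *P V k ^P (d₁ + d₂))
          ≈⟨ ~+ (sum-product n A₁ A₂) (~neg (sum-cong n (λ k _ _ → diagonal k))) ⟩
        (Tri n symmetric +P Σ1 n diag) -P Σ1 n diag
          ≈⟨ solve 2 (λ T D → (T :+ D) :- D := T) ~-refl (Tri n symmetric) (Σ1 n diag) ⟩
        Tri n symmetric
          ≈⟨ tri-+ n (λ j k → A₁ j *P A₂ k) (λ j k → A₁ k *P A₂ j) ⟩
        Tri n (λ j k → A₁ j *P A₂ k) +P Tri n (λ j k → A₁ k *P A₂ j)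
          ≈⟨ ~+ (~-refl {Tri n (λ j k → A₁ j *P A₂ k)})
                (~-trans (tri-reverse n (λ j k → A₁ k *P A₂ j)) (tri-cong n reflected-pair)) ⟩
        Tri n (λ j k → A₁ j *P A₂ k) +P Tri n (λ j k → s *P (Ā₁ j *P Ā₂ k)) ∎
      where
      open ~-Reasoning
      symmetric : ℕ → ℕ → Poly
      symmetric j k = A₁ j *P A₂ k +P A₁ k *P A₂ j
      diag : ℕ → Poly
      diag k = A₁ k *P A₂ k
      sign-product : (cst (sgn d₁) *P cst (sgn d₂)) ≋ s
      sign-product = ≋-trans (cst-* (sgn d₁) (sgn d₂)) (≡⇒≋ (cong cst (sym (sgn-+ d₁ d₂))))
      reflected-pair : ∀ j k → 1 ≤ j → j < k → k ≤ n → (A₁ (p ∸ j) *P A₂ (p ∸ k)) ~ (s *P (Ā₁ j *P Ā₂ k))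
      reflected-pair j k 1≤j j<k k≤n = ~-trans
        (~* (reflected-term b₁ b̄₁ j 1≤j (ℕP.≤-trans (ℕP.<⇒≤ j<k) k≤n))
            (reflected-term b₂ b̄₂ k (ℕP.≤-trans 1≤j (ℕP.<⇒≤ j<k)) k≤n))
        (~-trans (solve 4 (λ s₁ X s₂ Y → (s₁ :* X) :* (s₂ :* Y) := (s₁ :* s₂) :* (X :* Y)) ~-refl
                    (cst (sgn d₁)) (Ā₁ j) (cst (sgn d₂)) (Ā₂ k))
                 (~* (≋⇒~ sign-product) (~-refl {Ā₁ j *P Ā₂ k})))

    part-ii : CongF p 1 (lhs3 p b₁ b̄₁ b₂ b̄₂) (rhs3 p b₁ b̄₁ b₂ b̄₂)
    part-ii = congF-intro p 0
      (reduces-sum n (λ k 1≤k k≤n → reduces-sum (k ∸ 1) (λ j 1≤j j≤k-1 →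
         reduces-quotient {numerator j k} ~-refl
           (unit-* (unit-pow d₁ (unit j 1≤j (below 1≤k k≤n j≤k-1))) (unit-pow d₂ (unit k 1≤k k≤n))))))
      (reduces-- (reduces-* (reduces-sum n (λ j 1≤j j≤n → reduces-term d₁ j (qPow (b₁ * j)) 1≤j j≤n))
                            (reduces-sum n (λ k 1≤k k≤n → reduces-term d₂ k (qPow (b₂ * k)) 1≤k k≤n)))
                 (reduces-sum n (λ k 1≤k k≤n → reduces-term (d₁ + d₂) k (qPow ((b₁ + b₂) * k)) 1≤k k≤n)))
      (~-trans lhs-split (~-sym rhs-split))
      where
      unit : ∀ j → 1 ≤ j → j ≤ n → Unit (qInt j)
      unit j 1≤j j≤n = mkUnit (V j) (V-inverse j 1≤j j≤n)
      reduces-term : ∀ e j X → 1 ≤ j → j ≤ n → Reduces (X / (qInt j ^P e)) (X *P V j ^P e)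
      reduces-term e j X 1≤j j≤n = reduces-quotient ~-refl (unit-pow e (unit j 1≤j j≤n))
      below : ∀ {j k} → 1 ≤ k → k ≤ n → j ≤ k ∸ 1 → j ≤ n
      below {j} {suc k} _ k≤n j≤k = ℕP.≤-trans j≤k (ℕP.≤-trans (ℕP.n≤1+n k) k≤n)

mainTheorem5 : (p : ℕ) → Prime p → 2 < p →
    ((b b̄ a d : ℕ) → a * d ≡ b + b̄ → 0 < b + b̄ → gcd a p ≡ 1 →
      CongF p 2 (lhs1 p b b̄ a d) (rhs1 p b b̄ a d)
        × CongF p 2 (lhs2 p b b̄ a d) (rhs2 p b b̄ a d))
    × ((b₁ b̄₁ b₂ b̄₂ : ℕ) → 0 < b₁ + b̄₁ → 0 < b₂ + b̄₂ →
      CongF p 1 (lhs3 p b₁ b̄₁ b₂ b̄₂) (rhs3 p b₁ b̄₁ b₂ b̄₂))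
mainTheorem5 zero _ ()
mainTheorem5 (suc n) p-prime 2<p = part-i , part-ii
  where
  part-i : (b b̄ a d : ℕ) → a * d ≡ b + b̄ → 0 < b + b̄ → gcd a (suc n) ≡ 1 →
    CongF (suc n) 2 (lhs1 (suc n) b b̄ a d) (rhs1 (suc n) b b̄ a d)
      × CongF (suc n) 2 (lhs2 (suc n) b b̄ a d) (rhs2 (suc n) b b̄ a d)
  part-i b b̄ a d ad≡b+b̄ 0<b+b̄ gcd≡1 =
    PartI.part-i n a b b̄ d ad≡b+b̄ (positive-factor a d (subst (0 <_) (sym ad≡b+b̄) 0<b+b̄))
      (sgn-odd-prime (suc n) p-prime 2<p) Inverses.U Inverses.U-inverse
    where module Inverses = InversesModSquare n p-prime a (Coprimality.gcd≡1⇒coprime gcd≡1)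
  part-ii : (b₁ b̄₁ b₂ b̄₂ : ℕ) → 0 < b₁ + b̄₁ → 0 < b₂ + b̄₂ →
    CongF (suc n) 1 (lhs3 (suc n) b₁ b̄₁ b₂ b̄₂) (rhs3 (suc n) b₁ b̄₁ b₂ b̄₂)
  part-ii b₁ b̄₁ b₂ b̄₂ _ _ = PartII.part-ii n Inverses.V Inverses.V-inverse b₁ b̄₁ b₂ b̄₂
    where module Inverses = InversesModQInt n p-prime
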